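{- Let $a_n=\sum_{\pi\in\mathcal{D}_{31\text{ - }2}(n)}y^{\mu(\pi)}$ for $n\ge2$, with $a_1=0$, and for $2\le i\le n$ let $a_{n,i}$ be the same sum restricted to those $\pi$ whose flattened form has second letter $i$. Then for $n\ge4$, $$a_{n,i}=\delta_{i,3}\,y\,a_{n-2}+\sum_{j=i-1}^{n-1}a_{n-1,j},\qquad 3\le i\le n-1,$$ and moreover $a_{n,2}=a_{n-1}+ya_{n-2}$ for $n\ge3$ and $a_{n,n}=y$ for $n\ge2$.
   Context: Every permutation $\pi$ of $[n]=\{1,\dots,n\}$ is written in standard cycle form: each cycle is written starting with its smallest element, and the cycles are ordered from left to right by increasing first elements. The flattened form $\mathrm{flat}(\pi)$ is the word (in one-line notation) obtained by erasing the parentheses of the standard cycle form. A derangement is a permutation with no fixed points; $\mathcal{D}(n)$ is the set of derangements of $[n]$, and $\mu(\pi)$ denotes the number of cycles of $\pi$. A word $w=w_1\cdots w_n$ of distinct integers contains the vincular pattern $31\text{ - }2$ if there are indices $i$ and $k>i+1$ with $w_{i+1}<w_k<w_i$, and avoids it otherwise. $\mathcal{D}_{31\text{ - }2}(n)$ is the set of $\pi\in\mathcal{D}(n)$ such that $\mathrm{flat}(\pi)$ avoids $31\text{ - }2$. $\delta$ is the Kronecker delta. -}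

module Defs where

open import Level using (Level)
open import Data.Bool using (Bool; true; false; _∧_; _∨_; if_then_else_)
open import Data.Nat using (ℕ; zero; suc; _∸_; _<ᵇ_; _≡ᵇ_) renaming (_+_ to _+ℕ_)
open import Data.Fin using (Fin; toℕ) renaming (_≟_ to _≟ᶠ_)
open import Data.List using (List; []; _∷_; [_]; map; concatMap; concat; filter; length; foldr; upTo; allFin)
open import Data.Vec using (Vec; lookup; toList) renaming (_∷_ to _∷ᵥ_; [] to []ᵥ)
import Data.List.Relation.Unary.Unique.DecPropositional as UDP
open import Data.Bool.ListAction using (and; or)
open import Relation.Nullary.Decidable using (does)
open import Algebra.Bundles using (CommutativeSemiring)

allFuns : (m n : ℕ) → List (Vec (Fin n) m)
allFuns zero    n = [ []ᵥ ]
allFuns (suc m) n = concatMap (λ v → map (_∷ᵥ v) (allFin n)) (allFuns m n)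

-- Permutations of [n]: injective self-maps (one-line notation, 0-based: σ(i) = lookup σ i).
-- Each permutation occurs exactly once in this list.
perms : (n : ℕ) → List (Vec (Fin n) n)
perms n = filter (λ v → UDP.unique? (_≟ᶠ_ {n}) (toList v)) (allFuns n n)

-- The cycle of σ containing i, listed starting from i: i, σ i, σ² i, …
-- (orbits have length ≤ n, so fuel n suffices)
cycleFrom : {n : ℕ} → Vec (Fin n) n → Fin n → List (Fin n)
cycleFrom {n} σ i = i ∷ go n (lookup σ i)
  where
  go : ℕ → Fin n → List (Fin n)
  go zero    j = []
  go (suc k) j = if does (j ≟ᶠ i) then [] else (j ∷ go k (lookup σ j))

isLeader : {n : ℕ} → Vec (Fin n) n → Fin n → Bool
isLeader σ i = and (map (λ j → toℕ i Data.Nat.≤ᵇ toℕ j) (cycleFrom σ i))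

-- Standard cycle form: each cycle starts with its smallest element,
-- cycles ordered by increasing first elements. Letters shifted to 1..n.
cycleForm : {n : ℕ} → Vec (Fin n) n → List (List ℕ)
cycleForm {n} σ = map (λ i → map (λ j → suc (toℕ j)) (cycleFrom σ i))
                      (filter (λ i → isLeader σ i Data.Bool.≟ true) (allFin n))

flat : {n : ℕ} → Vec (Fin n) n → List ℕ
flat σ = concat (cycleForm σ)

μ : {n : ℕ} → Vec (Fin n) n → ℕ
μ σ = length (cycleForm σ)

isDerangement : {n : ℕ} → Vec (Fin n) n → Bool
isDerangement {n} σ = and (map (λ i → Data.Bool.not (does (lookup σ i ≟ᶠ i))) (allFin n))

contains31-2 : List ℕ → Bool
contains31-2 (a ∷ b ∷ rest) = or (map (λ c → (b <ᵇ c) ∧ (c <ᵇ a)) rest) ∨ contains31-2 (b ∷ rest)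
contains31-2 _ = false

secondLetterIs : ℕ → List ℕ → Bool
secondLetterIs i (_ ∷ b ∷ _) = b ≡ᵇ i
secondLetterIs i _ = false

D31-2 : (n : ℕ) → List (Vec (Fin n) n)
D31-2 n = filter (λ σ → (isDerangement σ ∧ Data.Bool.not (contains31-2 (flat σ))) Data.Bool.≟ true) (perms n)

module Poly {c ℓ : Level} (R : CommutativeSemiring c ℓ) where
  open CommutativeSemiring R

  pow : Carrier → ℕ → Carrier
  pow y zero    = 1#
  pow y (suc k) = y * pow y k

  sumR : List Carrier → Carrier
  sumR = foldr _+_ 0#

  a : Carrier → ℕ → Carrier
  a y n = sumR (map (λ σ → pow y (μ σ)) (D31-2 n))

  a2 : Carrier → ℕ → ℕ → Carrier
  a2 y n i = sumR (map (λ σ → pow y (μ σ))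
                   (filter (λ σ → secondLetterIs i (flat σ) Data.Bool.≟ true) (D31-2 n)))

  δ : ℕ → ℕ → Carrier
  δ i j = if i ≡ᵇ j then 1# else 0#

  rangeSum : (ℕ → Carrier) → ℕ → ℕ → Carrier
  rangeSum f lo hi = sumR (map (λ t → f (lo +ℕ t)) (upTo (suc hi ∸ lo)))

-- For a derangement π of [n] the second letter of flat(π) is i = π(1). Deleting i from the cycle
-- of 1 and closing up the labels is a bijection from the permutations of [n] with π(1) = i onto all
-- permutations σ of [n-1]. It preserves the number of cycles and turns flat(σ) = 1 j U into
-- flat(π) = 1 i j′ U′, where ′ is the relabelling. π is a derangement iff σ is, except when σ fixes 1:
-- then σ = (1)τ, and π = (1 i)τ′ has one cycle more than τ. An occurrence of 31-2 in flat(π) that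
-- does not come from flat(σ) starts at i, and since every letter of σ other than 1 and j occurs in U,
-- one exists iff j < i - 1 (iff i > 3 when σ = (1)τ, where j = 2). Summing over j gives
-- a_{n,i} = [i ≤ 3] y a_{n-2} + Σ_{j ≥ i-1} a_{n-1,j}, from which all three parts follow.

module Submission where

open import Defs
open import Level using (Level)
open import Data.Nat using (ℕ; _≤_; _∸_)
open import Data.Product using (_×_)
open import Algebra.Bundles using (CommutativeSemiring)

open import Data.Bool using (Bool; true; false; T; if_then_else_; _∧_; _∨_; not) renaming (_≟_ to _≟ᵇ_)
open import Data.Bool.Properties using (T-∧; ∧-zeroʳ; ∧-identityʳ; T-≡)
open import Data.Bool.ListAction using (and; or; all; any)
open import Data.Empty using (⊥-elim)
open import Data.Unit using (⊤)
open import Data.Fin using (Fin; zero; suc; toℕ; fromℕ<; punchIn; punchOut) renaming (_≟_ to _≟ᶠ_)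
import Data.Fin.Properties as Fin
open import Data.List using (List; []; _∷_; _++_; drop; map; filter; concat; concatMap; length; allFin; applyUpTo; upTo; cartesianProductWith)
import Data.List.Properties as List
open import Data.List.Membership.Propositional using (_∈_)
open import Data.List.Membership.Propositional.Properties using (∈-concatMap⁺; ∈-map⁺; ∈-map⁻; ∈-filter⁺; ∈-filter⁻; ∈-allFin)
open import Data.List.Membership.Propositional.Properties.WithK using (unique∧set⇒bag)
open import Data.List.Relation.Binary.BagAndSetEquality using (∼bag⇒↭)
open import Data.List.Relation.Binary.Permutation.Propositional using (_↭_)
open import Data.List.Relation.Unary.All as All using (All; []; _∷_)
open import Data.List.Relation.Unary.All.Properties using (all⁺; all⁻)
open import Data.List.Relation.Unary.Any as Any using (here; there; any?)
open import Data.List.Relation.Unary.Any.Properties using (any⁺; any⁻)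
import Data.List.Relation.Unary.AllPairs as AllPairs
open import Data.List.Relation.Unary.Unique.Propositional using (Unique)
import Data.List.Relation.Unary.Unique.Propositional.Properties as Unique
import Data.List.Relation.Unary.Unique.DecPropositional as UniqueDec
open import Data.Nat as ℕ using (zero; suc; _<_; z≤n; s≤s; _<ᵇ_; _≤ᵇ_; _≡ᵇ_)
import Data.Nat.Properties as ℕ
open import Data.Product using (∃; _,_; proj₁; proj₂)
open import Data.Vec as Vec using (Vec; lookup; toList; tabulate) renaming (_∷_ to _∷ᵥ_; [] to []ᵥ)
import Data.Vec.Properties as Vec
open import Function using (_∘_; case_of_; _⇔_; mk⇔; Injective; Equivalence)
open import Relation.Nullary using (¬_; Dec; yes; no)
open import Relation.Nullary.Decidable using (does)
open import Relation.Binary.PropositionalEquality using (_≡_; _≢_; refl; sym; trans; cong; cong₂; subst; module ≡-Reasoning)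

T-ext : ∀ {b c} → (T b → T c) → (T c → T b) → b ≡ c
T-ext {false} {false} _ _ = refl
T-ext {false} {true}  _ c⇒b = ⊥-elim (c⇒b _)
T-ext {true}  {false} b⇒c _ = ⊥-elim (b⇒c _)
T-ext {true}  {true}  _ _ = refl

≤ᵇ-suc : ∀ a b → (suc a ≤ᵇ suc b) ≡ (a ≤ᵇ b)
≤ᵇ-suc zero    b = refl
≤ᵇ-suc (suc a) b = refl

≤ᵇ-false : ∀ m n → n < m → (m ≤ᵇ n) ≡ false
≤ᵇ-false (suc m) zero    _         = refl
≤ᵇ-false (suc m) (suc n) (s≤s n<m) = trans (≤ᵇ-suc m n) (≤ᵇ-false m n n<m)

≤ᵇ-split : ∀ m n → (m ≤ᵇ n) ≡ ((n ≡ᵇ m) ∨ (suc m ≤ᵇ n))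
≤ᵇ-split zero    zero    = refl
≤ᵇ-split zero    (suc n) = refl
≤ᵇ-split (suc m) zero    = refl
≤ᵇ-split (suc m) (suc n) = trans (≤ᵇ-suc m n) (trans (≤ᵇ-split m n) (cong ((n ≡ᵇ m) ∨_) (sym (≤ᵇ-suc (suc m) n))))

≡ᵇ-∧-≤ᵇ : ∀ m n → ((n ≡ᵇ m) ∧ (suc m ≤ᵇ n)) ≡ false
≡ᵇ-∧-≤ᵇ zero    zero    = refl
≡ᵇ-∧-≤ᵇ zero    (suc n) = refl
≡ᵇ-∧-≤ᵇ (suc m) zero    = refl
≡ᵇ-∧-≤ᵇ (suc m) (suc n) = trans (cong ((n ≡ᵇ m) ∧_) (≤ᵇ-suc (suc m) n)) (≡ᵇ-∧-≤ᵇ m n)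

≤ᵇ-≡ᵇ : ∀ {k n} → k ≤ n → (n ≤ᵇ k) ≡ (k ≡ᵇ n)
≤ᵇ-≡ᵇ {zero}  {zero}  _         = refl
≤ᵇ-≡ᵇ {zero}  {suc n} _         = refl
≤ᵇ-≡ᵇ {suc k} {suc n} (s≤s k≤n) = trans (≤ᵇ-suc n k) (≤ᵇ-≡ᵇ k≤n)

not-<ᵇ : ∀ a b → not (a <ᵇ b) ≡ (b ≤ᵇ a)
not-<ᵇ a       zero    = refl
not-<ᵇ zero    (suc b) = refl
not-<ᵇ (suc a) (suc b) = trans (not-<ᵇ a b) (sym (≤ᵇ-suc b a))

∧-not-∨ : ∀ d x c → (d ∧ not (x ∨ c)) ≡ ((d ∧ not c) ∧ not x)
∧-not-∨ false x     c     = refl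
∧-not-∨ true  true  c     = sym (∧-zeroʳ (not c))
∧-not-∨ true  false c     = sym (∧-identityʳ (not c))

toℕ-≡ᵇ : ∀ {n} (a b : Fin n) → (toℕ a ≡ᵇ toℕ b) ≡ does (a ≟ᶠ b)
toℕ-≡ᵇ a b with a ≟ᶠ b
... | yes refl = Equivalence.to T-≡ (ℕ.≡⇒≡ᵇ (toℕ a) (toℕ a) refl)
... | no a≢b   = T-ext (λ t → a≢b (Fin.toℕ-injective (ℕ.≡ᵇ⇒≡ (toℕ a) (toℕ b) t))) (λ ())

punchIn-≤ᵇ : ∀ {n} p (a b : Fin n) → (toℕ (punchIn p a) ≤ᵇ toℕ (punchIn p b)) ≡ (toℕ a ≤ᵇ toℕ b)
punchIn-≤ᵇ zero    a       b       = ≤ᵇ-suc (toℕ a) (toℕ b)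
punchIn-≤ᵇ (suc p) zero    b       = refl
punchIn-≤ᵇ (suc p) (suc a) zero    = refl
punchIn-≤ᵇ (suc p) (suc a) (suc b) =
  trans (≤ᵇ-suc (toℕ (punchIn p a)) _) (trans (punchIn-≤ᵇ p a b) (sym (≤ᵇ-suc (toℕ a) (toℕ b))))

punchIn-<ᵇ : ∀ {n} q (a b : Fin n) → (toℕ (punchIn q a) <ᵇ toℕ (punchIn q b)) ≡ (toℕ a <ᵇ toℕ b)
punchIn-<ᵇ zero    a       b       = refl
punchIn-<ᵇ (suc q) zero    zero    = refl
punchIn-<ᵇ (suc q) zero    (suc b) = refl
punchIn-<ᵇ (suc q) (suc a) zero    = refl
punchIn-<ᵇ (suc q) (suc a) (suc b) = punchIn-<ᵇ q a b

punchIn-<ᵇ-self : ∀ {n} q (c : Fin n) → (toℕ (punchIn q c) <ᵇ toℕ q) ≡ (toℕ c <ᵇ toℕ q)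
punchIn-<ᵇ-self zero    c       = refl
punchIn-<ᵇ-self (suc q) zero    = refl
punchIn-<ᵇ-self (suc q) (suc c) = punchIn-<ᵇ-self q c

boolFilter : {A : Set} → (A → Bool) → List A → List A
boolFilter b = filter (λ x → b x ≟ᵇ true)

module _ {A : Set} (b : A → Bool) where

  boolFilter-∷-true : ∀ {x xs} → b x ≡ true → boolFilter b (x ∷ xs) ≡ x ∷ boolFilter b xs
  boolFilter-∷-true bx rewrite bx = refl

  boolFilter-∷-false : ∀ {x xs} → b x ≡ false → boolFilter b (x ∷ xs) ≡ boolFilter b xs
  boolFilter-∷-false bx rewrite bx = refl

  boolFilter-map : {B : Set} (f : B → A) (xs : List B) → boolFilter b (map f xs) ≡ map f (boolFilter (b ∘ f) xs)
  boolFilter-map f [] = refl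
  boolFilter-map f (x ∷ xs) with b (f x)
  ... | true  = cong (f x ∷_) (boolFilter-map f xs)
  ... | false = boolFilter-map f xs

  ∈-boolFilter⁻ : ∀ {x} xs → x ∈ boolFilter b xs → b x ≡ true
  ∈-boolFilter⁻ xs x∈ = proj₂ (∈-filter⁻ (λ x → b x ≟ᵇ true) {xs = xs} x∈)

boolFilter-∷-map : {A B : Set} (b : A → Bool) (c : B → Bool) (f : B → A) {y : B} {xs : List A} {ys : List B} →
  b (f y) ≡ c y → boolFilter b xs ≡ map f (boolFilter c ys) → boolFilter b (f y ∷ xs) ≡ map f (boolFilter c (y ∷ ys))
boolFilter-∷-map b c f {y} bc rest with b (f y) | c y | bc
... | true  | true  | _ = cong (f y ∷_) rest
... | false | false | _ = rest

boolFilter-cong : {A : Set} (b c : A → Bool) (xs : List A) → (∀ x → x ∈ xs → b x ≡ c x) → boolFilter b xs ≡ boolFilter c xs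
boolFilter-cong b c [] _ = refl
boolFilter-cong b c (x ∷ xs) b≡c with b x | c x | b≡c x (here refl)
... | true  | true  | _ = cong (x ∷_) (boolFilter-cong b c xs (λ y y∈ → b≡c y (there y∈)))
... | false | false | _ = boolFilter-cong b c xs (λ y y∈ → b≡c y (there y∈))

allFin-suc : ∀ n → allFin (suc n) ≡ zero ∷ map suc (allFin n)
allFin-suc n = cong (zero ∷_) (sym (List.map-tabulate (λ i → i) suc))

boolFilter-allFin-punchIn : ∀ {n} (b : Fin (suc n) → Bool) p → b p ≡ false →
  boolFilter b (allFin (suc n)) ≡ map (punchIn p) (boolFilter (b ∘ punchIn p) (allFin n))
boolFilter-allFin-punchIn {n} b zero bp = begin
  boolFilter b (allFin (suc n))             ≡⟨ cong (boolFilter b) (allFin-suc n) ⟩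
  boolFilter b (zero ∷ map suc (allFin n))  ≡⟨ boolFilter-∷-false b bp ⟩
  boolFilter b (map suc (allFin n))         ≡⟨ boolFilter-map b suc (allFin n) ⟩
  map suc (boolFilter (b ∘ suc) (allFin n)) ∎
  where open ≡-Reasoning
boolFilter-allFin-punchIn {suc n} b (suc p) bp = begin
  boolFilter b (allFin (suc (suc n)))
    ≡⟨ cong (boolFilter b) (allFin-suc (suc n)) ⟩
  boolFilter b (zero ∷ map suc (allFin (suc n)))
    ≡⟨ boolFilter-∷-map b (b ∘ pI) pI refl shifted ⟩
  map pI (boolFilter (b ∘ pI) (zero ∷ map suc (allFin n)))
    ≡⟨ cong (map pI ∘ boolFilter (b ∘ pI)) (sym (allFin-suc n)) ⟩
  map pI (boolFilter (b ∘ pI) (allFin (suc n))) ∎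
  where
  open ≡-Reasoning
  pI : Fin (suc n) → Fin (suc (suc n))
  pI = punchIn (suc p)
  shifted : boolFilter b (map suc (allFin (suc n))) ≡ map pI (boolFilter (b ∘ pI) (map suc (allFin n)))
  shifted = begin
    boolFilter b (map suc (allFin (suc n)))                                 ≡⟨ boolFilter-map b suc _ ⟩
    map suc (boolFilter (b ∘ suc) (allFin (suc n)))                         ≡⟨ cong (map suc) (boolFilter-allFin-punchIn (b ∘ suc) p bp) ⟩
    map suc (map (punchIn p) (boolFilter (b ∘ pI ∘ suc) (allFin n)))        ≡⟨ sym (List.map-∘ _) ⟩
    map (pI ∘ suc) (boolFilter (b ∘ pI ∘ suc) (allFin n))                   ≡⟨ List.map-∘ _ ⟩
    map pI (map suc (boolFilter (b ∘ pI ∘ suc) (allFin n)))                 ≡⟨ cong (map pI) (sym (boolFilter-map (b ∘ pI) suc (allFin n))) ⟩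
    map pI (boolFilter (b ∘ pI) (map suc (allFin n)))                       ∎

Perm : ℕ → Set
Perm n = Vec (Fin n) n

IsPerm : ∀ {n} → Perm n → Set
IsPerm σ = Injective _≡_ _≡_ (lookup σ)

lookup-ext : ∀ {A : Set} {n} (u v : Vec A n) → (∀ i → lookup u i ≡ lookup v i) → u ≡ v
lookup-ext u v u≗v = trans (sym (Vec.tabulate∘lookup u)) (trans (Vec.tabulate-cong u≗v) (Vec.tabulate∘lookup v))

module _ {A : Set} (P : A → Set) where

  All-toList⁻ : ∀ {k} (v : Vec A k) → All P (toList v) → ∀ i → P (lookup v i)
  All-toList⁻ (x ∷ᵥ v) (px ∷ _)  zero    = px
  All-toList⁻ (x ∷ᵥ v) (_  ∷ pv) (suc i) = All-toList⁻ v pv i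

  All-toList⁺ : ∀ {k} (v : Vec A k) → (∀ i → P (lookup v i)) → All P (toList v)
  All-toList⁺ []ᵥ      _  = []
  All-toList⁺ (x ∷ᵥ v) pv = pv zero ∷ All-toList⁺ v (pv ∘ suc)

Unique-toList⇒injective : ∀ {A : Set} {k} (v : Vec A k) → Unique (toList v) → Injective _≡_ _≡_ (lookup v)
Unique-toList⇒injective (x ∷ᵥ v) (x∉ AllPairs.∷ u) {zero}  {zero}  _ = refl
Unique-toList⇒injective (x ∷ᵥ v) (x∉ AllPairs.∷ u) {zero}  {suc b} e = ⊥-elim (All-toList⁻ _ v x∉ b e)
Unique-toList⇒injective (x ∷ᵥ v) (x∉ AllPairs.∷ u) {suc a} {zero}  e = ⊥-elim (All-toList⁻ _ v x∉ a (sym e))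
Unique-toList⇒injective (x ∷ᵥ v) (x∉ AllPairs.∷ u) {suc a} {suc b} e = cong suc (Unique-toList⇒injective v u e)

injective⇒Unique-toList : ∀ {A : Set} {k} (v : Vec A k) → Injective _≡_ _≡_ (lookup v) → Unique (toList v)
injective⇒Unique-toList []ᵥ      _   = AllPairs.[]
injective⇒Unique-toList (x ∷ᵥ v) inj =
  All-toList⁺ _ v (λ i e → Fin.0≢1+n (inj e)) AllPairs.∷ injective⇒Unique-toList v (Fin.suc-injective ∘ inj)

allFuns-unique : ∀ m n → Unique (allFuns m n)
allFuns-unique zero    n = [] AllPairs.∷ AllPairs.[]
allFuns-unique (suc m) n = subst Unique (sym (concatMap-cartesian (allFuns m n)))
  (Unique.cartesianProductWith⁺ (λ v x → x ∷ᵥ v) (λ e → Vec.∷-injectiveʳ e , Vec.∷-injectiveˡ e)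
    (allFuns-unique m n) (Unique.allFin⁺ n))
  where
  concatMap-cartesian : ∀ vs → concatMap (λ v → map (_∷ᵥ v) (allFin n)) vs ≡ cartesianProductWith (λ v x → x ∷ᵥ v) vs (allFin n)
  concatMap-cartesian []       = refl
  concatMap-cartesian (v ∷ vs) = cong (map (_∷ᵥ v) (allFin n) ++_) (concatMap-cartesian vs)

∈-allFuns : ∀ {m n} (v : Vec (Fin n) m) → v ∈ allFuns m n
∈-allFuns []ᵥ      = here refl
∈-allFuns {n = n} (x ∷ᵥ v) =
  ∈-concatMap⁺ (λ w → map (_∷ᵥ w) (allFin n)) (Any.map (λ { refl → ∈-map⁺ (_∷ᵥ v) (∈-allFin x) }) (∈-allFuns v))

perms-unique : ∀ n → Unique (perms n)
perms-unique n = Unique.filter⁺ _ (allFuns-unique n n)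

∈-perms⁺ : ∀ {n} (σ : Perm n) → IsPerm σ → σ ∈ perms n
∈-perms⁺ {n} σ inj = ∈-filter⁺ (λ v → UniqueDec.unique? (_≟ᶠ_ {n}) (toList v)) (∈-allFuns σ) (injective⇒Unique-toList σ inj)

∈-perms⁻ : ∀ {n} {σ : Perm n} → σ ∈ perms n → IsPerm σ
∈-perms⁻ {n} {σ} σ∈ =
  Unique-toList⇒injective σ (proj₂ (∈-filter⁻ (λ v → UniqueDec.unique? (_≟ᶠ_ {n}) (toList v)) {xs = allFuns n n} σ∈))

-- Inserting a letter after 0, and fixing 0

-- In cycle notation insertAfterZero p σ turns the cycle (0 a …) of σ into (0 p+1 a′ …),
-- where ′ relabels every letter of σ by punchIn (suc p).
insertedValue : ∀ {m} → Fin (suc m) → Perm (suc m) → Fin (suc (suc m)) → Fin (suc (suc m))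
insertedValue p σ zero = suc p
insertedValue p σ (suc x) with p ≟ᶠ x
... | yes _  = punchIn (suc p) (lookup σ zero)
... | no p≢x = punchIn (suc p) (lookup σ (suc (punchOut p≢x)))

insertAfterZero : ∀ {m} → Fin (suc m) → Perm (suc m) → Perm (suc (suc m))
insertAfterZero p σ = tabulate (insertedValue p σ)

data Position {m} (p : Fin (suc m)) : Fin (suc (suc m)) → Set where
  atZero   : Position p zero
  atTarget : Position p (suc p)
  atOther  : ∀ k → Position p (punchIn (suc p) (suc k))

position : ∀ {m} (p : Fin (suc m)) x → Position p x
position p zero = atZero
position p (suc x) with p ≟ᶠ x
... | yes refl = atTarget
... | no p≢x   = subst (Position p) (cong suc (Fin.punchIn-punchOut p≢x)) (atOther (punchOut p≢x))

module _ {m} (p : Fin (suc m)) (σ : Perm (suc m)) where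

  insertAfterZero-zero : lookup (insertAfterZero p σ) zero ≡ suc p
  insertAfterZero-zero = Vec.lookup∘tabulate (insertedValue p σ) zero

  insertAfterZero-target : lookup (insertAfterZero p σ) (suc p) ≡ punchIn (suc p) (lookup σ zero)
  insertAfterZero-target = trans (Vec.lookup∘tabulate (insertedValue p σ) (suc p)) value
    where
    value : insertedValue p σ (suc p) ≡ punchIn (suc p) (lookup σ zero)
    value with p ≟ᶠ p
    ... | yes _  = refl
    ... | no p≢p = ⊥-elim (p≢p refl)

  insertAfterZero-other : ∀ k → lookup (insertAfterZero p σ) (punchIn (suc p) (suc k)) ≡ punchIn (suc p) (lookup σ (suc k))
  insertAfterZero-other k = trans (Vec.lookup∘tabulate (insertedValue p σ) (punchIn (suc p) (suc k))) value
    where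
    value : insertedValue p σ (punchIn (suc p) (suc k)) ≡ punchIn (suc p) (lookup σ (suc k))
    value with p ≟ᶠ punchIn p k
    ... | yes p≡ = ⊥-elim (Fin.punchInᵢ≢i p k (sym p≡))
    ... | no p≢  = cong (λ j → punchIn (suc p) (lookup σ (suc j))) (trans (Fin.punchOut-cong p refl) (Fin.punchOut-punchIn p))

  insertAfterZero-isPerm : IsPerm σ → IsPerm (insertAfterZero p σ)
  insertAfterZero-isPerm inj {a} {b} e with position p a | position p b
  ... | atZero    | atZero    = refl
  ... | atZero    | atTarget  = ⊥-elim (Fin.punchInᵢ≢i (suc p) _ (trans (sym insertAfterZero-target) (trans (sym e) insertAfterZero-zero)))
  ... | atZero    | atOther l = ⊥-elim (Fin.punchInᵢ≢i (suc p) _ (trans (sym (insertAfterZero-other l)) (trans (sym e) insertAfterZero-zero)))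
  ... | atTarget  | atZero    = ⊥-elim (Fin.punchInᵢ≢i (suc p) _ (trans (sym insertAfterZero-target) (trans e insertAfterZero-zero)))
  ... | atTarget  | atTarget  = refl
  ... | atTarget  | atOther l = ⊥-elim (Fin.0≢1+n (inj (Fin.punchIn-injective (suc p) _ _
                                  (trans (sym insertAfterZero-target) (trans e (insertAfterZero-other l))))))
  ... | atOther k | atZero    = ⊥-elim (Fin.punchInᵢ≢i (suc p) _ (trans (sym (insertAfterZero-other k)) (trans e insertAfterZero-zero)))
  ... | atOther k | atTarget  = ⊥-elim (Fin.0≢1+n (inj (Fin.punchIn-injective (suc p) _ _
                                  (trans (sym insertAfterZero-target) (trans (sym e) (insertAfterZero-other k))))))
  ... | atOther k | atOther l = cong (punchIn (suc p)) (inj (Fin.punchIn-injective (suc p) _ _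
                                  (trans (sym (insertAfterZero-other k)) (trans e (insertAfterZero-other l)))))

insertAfterZero-injective : ∀ {m} (p : Fin (suc m)) → Injective _≡_ _≡_ (insertAfterZero p)
insertAfterZero-injective p {σ} {τ} e = lookup-ext σ τ same
  where
  same : ∀ k → lookup σ k ≡ lookup τ k
  same zero    = Fin.punchIn-injective (suc p) _ _
    (trans (sym (insertAfterZero-target p σ)) (trans (cong (λ π → lookup π (suc p)) e) (insertAfterZero-target p τ)))
  same (suc k) = Fin.punchIn-injective (suc p) _ _
    (trans (sym (insertAfterZero-other p σ k)) (trans (cong (λ π → lookup π (punchIn (suc p) (suc k))) e) (insertAfterZero-other p τ k)))

fixZero : ∀ {m} → Perm m → Perm (suc m)
fixZero τ = zero ∷ᵥ Vec.map suc τ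

fixZero-suc : ∀ {m} (τ : Perm m) k → lookup (fixZero τ) (suc k) ≡ suc (lookup τ k)
fixZero-suc τ k = Vec.lookup-map k suc τ

fixZero-isPerm : ∀ {m} {τ : Perm m} → IsPerm τ → IsPerm (fixZero τ)
fixZero-isPerm         inj {zero}  {zero}  e = refl
fixZero-isPerm {τ = τ} inj {zero}  {suc b} e = ⊥-elim (Fin.0≢1+n (trans e (fixZero-suc τ b)))
fixZero-isPerm {τ = τ} inj {suc a} {zero}  e = ⊥-elim (Fin.0≢1+n (trans (sym e) (fixZero-suc τ a)))
fixZero-isPerm {τ = τ} inj {suc a} {suc b} e =
  cong suc (inj (Fin.suc-injective (trans (sym (fixZero-suc τ a)) (trans e (fixZero-suc τ b)))))

fixZero-injective : ∀ {m} → Injective _≡_ _≡_ (fixZero {m})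
fixZero-injective {x = σ} {τ} e = lookup-ext σ τ
  (λ k → Fin.suc-injective (trans (sym (fixZero-suc σ k)) (trans (cong (λ π → lookup π (suc k)) e) (fixZero-suc τ k))))

data ZeroView : ∀ {n} → Perm n → Set where
  fixed    : ∀ {m} (τ : Perm m) → IsPerm τ → ZeroView (fixZero τ)
  inserted : ∀ {m} (p : Fin (suc m)) (σ : Perm (suc m)) → IsPerm σ → ZeroView (insertAfterZero p σ)

private
  module Unfix {m} (π : Perm (suc m)) (inj : IsPerm π) (π0 : lookup π zero ≡ zero) where

    nonzero : ∀ k → zero ≢ lookup π (suc k)
    nonzero k e = Fin.0≢1+n (inj (trans π0 e))

    τ : Perm m
    τ = tabulate (λ k → punchOut (nonzero k))

    τ-isPerm : IsPerm τ
    τ-isPerm {a} {b} e = Fin.suc-injective (inj (Fin.punchOut-injective (nonzero a) (nonzero b)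
      (trans (sym (Vec.lookup∘tabulate (λ k → punchOut (nonzero k)) a)) (trans e (Vec.lookup∘tabulate (λ k → punchOut (nonzero k)) b)))))

    fixZero-τ : fixZero τ ≡ π
    fixZero-τ = lookup-ext (fixZero τ) π agree
      where
      agree : ∀ x → lookup (fixZero τ) x ≡ lookup π x
      agree zero    = sym π0
      agree (suc k) = trans (fixZero-suc τ k) (trans (cong suc (Vec.lookup∘tabulate (λ k → punchOut (nonzero k)) k)) (Fin.punchIn-punchOut (nonzero k)))

  module Remove {m} (p : Fin (suc m)) (π : Perm (suc (suc m))) (inj : IsPerm π) (π0 : lookup π zero ≡ suc p) where

    source : Fin (suc m) → Fin (suc (suc m))
    source zero    = suc p
    source (suc j) = punchIn (suc p) (suc j)

    source-injective : Injective _≡_ _≡_ source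
    source-injective {zero}  {zero}  _ = refl
    source-injective {zero}  {suc b} e = ⊥-elim (Fin.punchInᵢ≢i (suc p) (suc b) (sym e))
    source-injective {suc a} {zero}  e = ⊥-elim (Fin.punchInᵢ≢i (suc p) (suc a) e)
    source-injective {suc a} {suc b} e = Fin.punchIn-injective (suc p) _ _ e

    missesTarget : ∀ k → suc p ≢ lookup π (source k)
    missesTarget zero    e = Fin.0≢1+n (inj (trans π0 e))
    missesTarget (suc j) e = Fin.0≢1+n (inj (trans π0 e))

    σ : Perm (suc m)
    σ = tabulate (λ k → punchOut (missesTarget k))

    σ-value : ∀ k → punchIn (suc p) (lookup σ k) ≡ lookup π (source k)
    σ-value k = trans (cong (punchIn (suc p)) (Vec.lookup∘tabulate (λ k → punchOut (missesTarget k)) k)) (Fin.punchIn-punchOut (missesTarget k))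

    σ-isPerm : IsPerm σ
    σ-isPerm {a} {b} e = source-injective (inj (trans (sym (σ-value a)) (trans (cong (punchIn (suc p)) e) (σ-value b))))

    insertAfterZero-σ : insertAfterZero p σ ≡ π
    insertAfterZero-σ = lookup-ext (insertAfterZero p σ) π agree
      where
      agree : ∀ x → lookup (insertAfterZero p σ) x ≡ lookup π x
      agree x with position p x
      ... | atZero    = trans (insertAfterZero-zero p σ) (sym π0)
      ... | atTarget  = trans (insertAfterZero-target p σ) (σ-value zero)
      ... | atOther k = trans (insertAfterZero-other p σ k) (σ-value (suc k))

zeroView : ∀ {n} (π : Perm (suc n)) → IsPerm π → ZeroView π
zeroView {n} π inj with lookup π zero in π0
zeroView {n}     π inj | zero  = subst ZeroView (Unfix.fixZero-τ π inj π0) (fixed _ (Unfix.τ-isPerm π inj π0))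
zeroView {suc m} π inj | suc p = subst ZeroView (Remove.insertAfterZero-σ p π inj π0) (inserted p _ (Remove.σ-isPerm p π inj π0))

sameMembers⇒↭ : ∀ {A : Set} {xs ys : List A} → Unique xs → Unique ys → (∀ {x} → x ∈ xs ⇔ x ∈ ys) → xs ↭ ys
sameMembers⇒↭ uxs uys same = ∼bag⇒↭ (unique∧set⇒bag uxs uys same)

perms-startingWith : ∀ {m} (p : Fin (suc m)) →
  filter (λ π → lookup π zero ≟ᶠ suc p) (perms (suc (suc m))) ↭ map (insertAfterZero p) (perms (suc m))
perms-startingWith {m} p = sameMembers⇒↭
  (Unique.filter⁺ _ (perms-unique _)) (Unique.map⁺ (insertAfterZero-injective p) (perms-unique _)) (mk⇔ to from)
  where
  startsWith? : (π : Perm (suc (suc m))) → Dec (lookup π zero ≡ suc p)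
  startsWith? π = lookup π zero ≟ᶠ suc p
  to : ∀ {π} → π ∈ filter startsWith? (perms (suc (suc m))) → π ∈ map (insertAfterZero p) (perms (suc m))
  to {π} π∈ with ∈-filter⁻ startsWith? {xs = perms _} π∈
  ... | π∈perms , π0 with zeroView π (∈-perms⁻ π∈perms)
  ...   | fixed τ _ = ⊥-elim (Fin.0≢1+n π0)
  ...   | inserted q σ σ-perm with refl ← Fin.suc-injective (trans (sym (insertAfterZero-zero q σ)) π0) =
    ∈-map⁺ (insertAfterZero p) (∈-perms⁺ σ σ-perm)
  from : ∀ {π} → π ∈ map (insertAfterZero p) (perms (suc m)) → π ∈ filter startsWith? (perms (suc (suc m)))
  from π∈ with ∈-map⁻ (insertAfterZero p) π∈
  ... | σ , σ∈ , refl = ∈-filter⁺ startsWith? (∈-perms⁺ _ (insertAfterZero-isPerm p σ (∈-perms⁻ σ∈))) (insertAfterZero-zero p σ)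

perms-fixingZero : ∀ {m} → filter (λ σ → lookup σ zero ≟ᶠ zero) (perms (suc m)) ↭ map fixZero (perms m)
perms-fixingZero {m} = sameMembers⇒↭
  (Unique.filter⁺ _ (perms-unique _)) (Unique.map⁺ fixZero-injective (perms-unique _)) (mk⇔ to from)
  where
  fixesZero? : (σ : Perm (suc m)) → Dec (lookup σ zero ≡ zero)
  fixesZero? σ = lookup σ zero ≟ᶠ zero
  to : ∀ {σ} → σ ∈ filter fixesZero? (perms (suc m)) → σ ∈ map fixZero (perms m)
  to {σ} σ∈ with ∈-filter⁻ fixesZero? {xs = perms _} σ∈
  ... | σ∈perms , σ0 with zeroView σ (∈-perms⁻ σ∈perms)
  ...   | fixed τ τ-perm = ∈-map⁺ fixZero (∈-perms⁺ τ τ-perm)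
  ...   | inserted q σ′ _ = ⊥-elim (Fin.0≢1+n (trans (sym σ0) (insertAfterZero-zero q σ′)))
  from : ∀ {σ} → σ ∈ map fixZero (perms m) → σ ∈ filter fixesZero? (perms (suc m))
  from σ∈ with ∈-map⁻ fixZero σ∈
  ... | τ , τ∈ , refl = ∈-filter⁺ fixesZero? (∈-perms⁺ _ (fixZero-isPerm (∈-perms⁻ τ∈))) refl

-- Orbits

-- The loop of cycleFrom is where-bound and cannot be named: cycleTail is a metavariable,
-- solved by unifying it with that loop in a goal where all its arguments are variables.
mutual
  cycleTail : ∀ {n} → Perm n → Fin n → ℕ → Fin n → List (Fin n)
  cycleTail = _

  private
    cycleTail-solution : ∀ w (σ : Perm (suc w)) i → drop 1 (cycleFrom σ i) ≡
      (if does (lookup σ i ≟ᶠ i) then [] else lookup σ i ∷ cycleTail σ i w (lookup σ (lookup σ i)))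
    cycleTail-solution w with suc w
    ... | n with w
    ... | k = unfolded
      where
      unfolded : _
      unfolded σ i with lookup σ (lookup σ i)
      ... | _ = refl

iterate : ∀ {n} → Perm n → ℕ → Fin n → Fin n
iterate σ zero    x = x
iterate σ (suc t) x = iterate σ t (lookup σ x)

iterate-suc : ∀ {n} (σ : Perm n) t x → iterate σ (suc t) x ≡ lookup σ (iterate σ t x)
iterate-suc σ zero    x = refl
iterate-suc σ (suc t) x = iterate-suc σ t (lookup σ x)

module _ {n} {σ : Perm n} (inj : IsPerm σ) where

  iterate-cancel : ∀ a c x → iterate σ a x ≡ iterate σ (a ℕ.+ c) x → x ≡ iterate σ c x
  iterate-cancel zero    c x e = e
  iterate-cancel (suc a) c x e =
    iterate-cancel a c x (inj (trans (sym (iterate-suc σ a x)) (trans e (iterate-suc σ (a ℕ.+ c) x))))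

  orbit-returns : ∀ i → ∃ λ d → d < n × iterate σ d (lookup σ i) ≡ i
  orbit-returns i with Fin.pigeonhole (ℕ.n<1+n n) (λ (t : Fin (suc n)) → iterate σ (toℕ t) i)
  ... | a , b , a<b , e = returns (toℕ a) (toℕ b) a<b (Fin.toℕ<n b) e
    where
    returns : ∀ a b → a < b → b < suc n → iterate σ a i ≡ iterate σ b i → ∃ λ d → d < n × iterate σ d (lookup σ i) ≡ i
    returns a b a<b b≤n e with ℕ.m≤n⇒∃[o]m+o≡n a<b
    ... | d , refl = d , ℕ.≤-trans (s≤s (ℕ.m≤n+m d a)) (ℕ.≤-pred b≤n) ,
                     sym (iterate-cancel a (suc d) i (trans e (cong (λ t → iterate σ t i) (sym (ℕ.+-suc a d)))))

cycleTail-fuel : ∀ {n} (σ : Perm n) i d y {k k′} → iterate σ d y ≡ i → d < k → d < k′ → cycleTail σ i k y ≡ cycleTail σ i k′ y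
cycleTail-fuel σ i zero y {suc k} {suc k′} e _ _ with y ≟ᶠ i
... | yes _  = refl
... | no y≢i = ⊥-elim (y≢i e)
cycleTail-fuel σ i (suc d) y {suc k} {suc k′} e (s≤s d<k) (s≤s d<k′) with y ≟ᶠ i
... | yes _ = refl
... | no _  = cong (y ∷_) (cycleTail-fuel σ i d (lookup σ y) e d<k d<k′)

cycleTail-avoids : ∀ {n} (σ : Perm n) i k y → All (_≢ i) (cycleTail σ i k y)
cycleTail-avoids σ i zero    y = []
cycleTail-avoids σ i (suc k) y with y ≟ᶠ i
... | yes _  = []
... | no y≢i = y≢i ∷ cycleTail-avoids σ i k (lookup σ y)

module Transport {m n} {σ : Perm m} {π : Perm n} {f : Fin m → Fin n} (f-injective : Injective _≡_ _≡_ f)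
                 (P : Fin m → Set) (commutes : ∀ j → P j → lookup π (f j) ≡ f (lookup σ j)) where

  cycleTail-map : ∀ i k y → All P (cycleTail σ i k y) → cycleTail π (f i) k (f y) ≡ map f (cycleTail σ i k y)
  cycleTail-map i zero    y _ = refl
  cycleTail-map i (suc k) y all-P with y ≟ᶠ i | f y ≟ᶠ f i
  ... | yes _   | yes _    = refl
  ... | yes y≡i | no fy≢fi = ⊥-elim (fy≢fi (cong f y≡i))
  ... | no y≢i  | yes fy≡fi = ⊥-elim (y≢i (f-injective fy≡fi))
  ... | no _    | no _  with all-P
  ...   | Py ∷ all-P′ = cong (f y ∷_) (trans (cong (cycleTail π (f i) k) (commutes y Py)) (cycleTail-map i k (lookup σ y) all-P′))

  ∈-cycleTail-map : ∀ {z} i k k′ y → z ∈ cycleTail σ i k y → k ≤ k′ → (∀ j → j ≢ z → P j) → f z ∈ cycleTail π (f i) k′ (f y)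
  ∈-cycleTail-map {z} i (suc k) (suc k′) y z∈ (s≤s k≤k′) P-off-z with y ≟ᶠ i | f y ≟ᶠ f i
  ∈-cycleTail-map {z} i (suc k) (suc k′) y () (s≤s k≤k′) P-off-z | yes _ | _
  ... | no y≢i | yes fy≡fi = ⊥-elim (y≢i (f-injective fy≡fi))
  ... | no _   | no _  with z∈
  ...   | here z≡y = here (cong f z≡y)
  ...   | there z∈′ with y ≟ᶠ z
  ...     | yes y≡z = here (cong f (sym y≡z))
  ...     | no y≢z  = there (subst (λ w → f z ∈ cycleTail π (f i) k′ w) (sym (commutes y (P-off-z y y≢z)))
                                    (∈-cycleTail-map i k k′ (lookup σ y) z∈′ k≤k′ P-off-z))

  ∈-cycleTail-reach : ∀ {z} s d k y → iterate σ d y ≡ z → d < k → (∀ j → j ≢ z → P j) → (∀ j → f j ≢ s) →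
                      f z ∈ cycleTail π s k (f y)
  ∈-cycleTail-reach s zero (suc k) y y≡z _ P-off-z misses with f y ≟ᶠ s
  ... | yes fy≡s = ⊥-elim (misses y fy≡s)
  ... | no _     = here (cong f (sym y≡z))
  ∈-cycleTail-reach {z} s (suc d) (suc k) y reach (s≤s d<k) P-off-z misses with f y ≟ᶠ s
  ... | yes fy≡s = ⊥-elim (misses y fy≡s)
  ... | no _ with y ≟ᶠ z
  ...   | yes y≡z = here (cong f (sym y≡z))
  ...   | no y≢z  = there (subst (λ w → f z ∈ cycleTail π s k w) (sym (commutes y (P-off-z y y≢z)))
                                 (∈-cycleTail-reach s d k (lookup σ y) reach d<k P-off-z misses))

-- Cycle form

-- The letters of flat are 1-based: j : Fin n is written as the letter suc (toℕ j).
label : ∀ {n} → Fin n → ℕ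
label j = suc (toℕ j)

leaders : ∀ {n} → Perm n → List (Fin n)
leaders σ = boolFilter (isLeader σ) (allFin _)

cycles : ∀ {n} → Perm n → List (List (Fin n))
cycles σ = map (cycleFrom σ) (leaders σ)

flat-cycles : ∀ {n} (σ : Perm n) → flat σ ≡ map label (concat (cycles σ))
flat-cycles σ = trans (cong concat (List.map-∘ (leaders σ))) (List.concat-map (cycles σ))

μ-cycles : ∀ {n} (σ : Perm n) → μ σ ≡ length (cycles σ)
μ-cycles σ = trans (cong length (List.map-∘ (leaders σ))) (List.length-map (map label) (cycles σ))

isLeader-map : ∀ {m n} {σ : Perm m} {π : Perm n} (f : Fin m → Fin n) →
  (∀ a b → (toℕ (f a) ≤ᵇ toℕ (f b)) ≡ (toℕ a ≤ᵇ toℕ b)) →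
  ∀ k → cycleFrom π (f k) ≡ map f (cycleFrom σ k) → isLeader π (f k) ≡ isLeader σ k
isLeader-map {σ = σ} {π} f f-≤ᵇ k cycle = begin
  all (λ j → toℕ (f k) ≤ᵇ toℕ j) (cycleFrom π (f k))       ≡⟨ cong (all (λ j → toℕ (f k) ≤ᵇ toℕ j)) cycle ⟩
  and (map (λ j → toℕ (f k) ≤ᵇ toℕ j) (map f (cycleFrom σ k))) ≡⟨ cong and (sym (List.map-∘ (cycleFrom σ k))) ⟩
  and (map (λ j → toℕ (f k) ≤ᵇ toℕ (f j)) (cycleFrom σ k))   ≡⟨ cong and (List.map-cong (f-≤ᵇ k) (cycleFrom σ k)) ⟩
  isLeader σ k ∎
  where open ≡-Reasoning

isLeader-false : ∀ {m} (σ : Perm (suc m)) k → zero ∈ cycleFrom σ (suc k) → isLeader σ (suc k) ≡ false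
isLeader-false σ k 0∈ with isLeader σ (suc k) in leader
... | false = refl
... | true  = ⊥-elim (All.lookup (all⁺ _ (cycleFrom σ (suc k)) (Equivalence.from T-≡ leader)) 0∈)

isLeader-zero : ∀ {m} (σ : Perm (suc m)) → isLeader σ zero ≡ true
isLeader-zero σ = Equivalence.to T-≡ (all⁻ (λ j → 0 ≤ᵇ toℕ j) (All.universal _ (cycleFrom σ zero)))

module _ {m} (σ : Perm (suc m)) where

  otherLeaders : List (Fin m)
  otherLeaders = boolFilter (isLeader σ ∘ suc) (allFin m)

  otherCycles : List (List (Fin (suc m)))
  otherCycles = map (cycleFrom σ ∘ suc) otherLeaders

  flatTail : List (Fin (suc m))
  flatTail = cycleTail σ zero (suc m) (lookup σ zero) ++ concat otherCycles

  leaders-suc : leaders σ ≡ zero ∷ map suc otherLeaders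
  leaders-suc = trans (cong (boolFilter (isLeader σ)) (allFin-suc m))
                      (trans (boolFilter-∷-true (isLeader σ) (isLeader-zero σ)) (cong (zero ∷_) (boolFilter-map (isLeader σ) suc (allFin m))))

  cycles-suc : cycles σ ≡ cycleFrom σ zero ∷ otherCycles
  cycles-suc = trans (cong (map (cycleFrom σ)) leaders-suc) (cong (cycleFrom σ zero ∷_) (sym (List.map-∘ otherLeaders)))

  concat-cycles-suc : concat (cycles σ) ≡ zero ∷ flatTail
  concat-cycles-suc = cong concat cycles-suc

  flat-flatTail : flat σ ≡ 1 ∷ map label flatTail
  flat-flatTail = trans (flat-cycles σ) (cong (map label) concat-cycles-suc)

  μ-otherCycles : μ σ ≡ suc (length otherCycles)
  μ-otherCycles = trans (μ-cycles σ) (cong length cycles-suc)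

module InsertedCycles {m} (p : Fin (suc m)) (σ : Perm (suc m)) (inj : IsPerm σ) where

  private
    π : Perm (suc (suc m))
    π = insertAfterZero p σ

    pI : Fin (suc m) → Fin (suc (suc m))
    pI = punchIn (suc p)

    commutes : ∀ j → j ≢ zero → lookup π (pI j) ≡ pI (lookup σ j)
    commutes zero    0≢0 = ⊥-elim (0≢0 refl)
    commutes (suc k) _   = insertAfterZero-other p σ k

  open Transport {σ = σ} {π = π} (λ {a} {b} → Fin.punchIn-injective (suc p) a b) (_≢ zero) commutes

  cycleFrom-zero : cycleFrom π zero ≡ zero ∷ suc p ∷ map pI (cycleTail σ zero (suc m) (lookup σ zero))
  cycleFrom-zero = cong (zero ∷_) (trans (cong (cycleTail π zero (suc (suc m))) (insertAfterZero-zero p σ))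
    (cong (suc p ∷_) (trans (cong (cycleTail π zero (suc m)) (insertAfterZero-target p σ))
      (cycleTail-map zero (suc m) (lookup σ zero) (cycleTail-avoids σ zero (suc m) (lookup σ zero))))))

  isLeader-target : isLeader π (suc p) ≡ false
  isLeader-target with orbit-returns inj zero
  ... | d , d<m , returns = isLeader-false π p (there 0∈)
    where
    0∈ : zero ∈ cycleTail π (suc p) (suc (suc m)) (lookup π (suc p))
    0∈ = subst (λ y → zero ∈ cycleTail π (suc p) (suc (suc m)) y) (sym (insertAfterZero-target p σ))
           (∈-cycleTail-reach (suc p) d (suc (suc m)) (lookup σ zero) returns (ℕ.m≤n⇒m≤1+n d<m) (λ _ j≢0 → j≢0) (Fin.punchInᵢ≢i (suc p)))

  cycleFrom-punchIn : ∀ k → ¬ zero ∈ cycleFrom σ (suc k) → cycleFrom π (pI (suc k)) ≡ map pI (cycleFrom σ (suc k))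
  cycleFrom-punchIn k 0∉ with orbit-returns inj (suc k)
  ... | d , d<m , returns = cong (pI (suc k) ∷_) (begin
    cycleTail π (pI (suc k)) (suc (suc m)) (lookup π (pI (suc k)))   ≡⟨ cong (cycleTail π (pI (suc k)) (suc (suc m))) (insertAfterZero-other p σ k) ⟩
    cycleTail π (pI (suc k)) (suc (suc m)) (pI (lookup σ (suc k)))    ≡⟨ cycleTail-map (suc k) (suc (suc m)) (lookup σ (suc k)) avoids-0 ⟩
    map pI (cycleTail σ (suc k) (suc (suc m)) (lookup σ (suc k)))     ≡⟨ cong (map pI) (sym enough-fuel) ⟩
    map pI (cycleTail σ (suc k) (suc m) (lookup σ (suc k)))           ∎)
    where
    open ≡-Reasoning
    enough-fuel : cycleTail σ (suc k) (suc m) (lookup σ (suc k)) ≡ cycleTail σ (suc k) (suc (suc m)) (lookup σ (suc k))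
    enough-fuel = cycleTail-fuel σ (suc k) d (lookup σ (suc k)) returns d<m (ℕ.m≤n⇒m≤1+n d<m)
    avoids-0 : All (_≢ zero) (cycleTail σ (suc k) (suc (suc m)) (lookup σ (suc k)))
    avoids-0 = All.tabulate (λ { {j} j∈ refl → 0∉ (there (subst (zero ∈_) (sym enough-fuel) j∈)) })

  isLeader-punchIn : ∀ k → isLeader π (pI k) ≡ isLeader σ k
  isLeader-punchIn zero = trans (isLeader-zero π) (sym (isLeader-zero σ))
  isLeader-punchIn (suc k) with any? (zero ≟ᶠ_) (cycleFrom σ (suc k))
  ... | yes 0∈ = trans (isLeader-false π (punchIn p k) (there (0∈π 0∈))) (sym (isLeader-false σ k 0∈))
    where
    0∈π : zero ∈ cycleFrom σ (suc k) → zero ∈ cycleTail π (pI (suc k)) (suc (suc m)) (lookup π (pI (suc k)))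
    0∈π (here 0≡)       = ⊥-elim (Fin.0≢1+n 0≡)
    0∈π (there 0∈tail) = subst (λ y → zero ∈ cycleTail π (pI (suc k)) (suc (suc m)) y) (sym (insertAfterZero-other p σ k))
                          (∈-cycleTail-map (suc k) (suc m) (suc (suc m)) (lookup σ (suc k)) 0∈tail (ℕ.n≤1+n (suc m)) (λ _ j≢0 → j≢0))
  ... | no 0∉  = isLeader-map pI (punchIn-≤ᵇ (suc p)) (suc k) (cycleFrom-punchIn k 0∉)

  leaders-insert : leaders π ≡ map pI (leaders σ)
  leaders-insert = trans (boolFilter-allFin-punchIn (isLeader π) (suc p) isLeader-target)
                         (cong (map pI) (boolFilter-cong _ _ (allFin (suc m)) (λ k _ → isLeader-punchIn k)))

  otherCycles-insert : otherCycles π ≡ map (map pI) (otherCycles σ)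
  otherCycles-insert = List.∷-injectiveʳ (begin
    cycleFrom π zero ∷ otherCycles π
      ≡⟨ sym (cycles-suc π) ⟩
    map (cycleFrom π) (leaders π)
      ≡⟨ cong (map (cycleFrom π)) (trans leaders-insert (cong (map pI) (leaders-suc σ))) ⟩
    cycleFrom π zero ∷ map (cycleFrom π) (map pI (map suc (otherLeaders σ)))
      ≡⟨ cong (cycleFrom π zero ∷_) (trans (cong (map (cycleFrom π)) (sym (List.map-∘ _))) (sym (List.map-∘ _))) ⟩
    cycleFrom π zero ∷ map (cycleFrom π ∘ pI ∘ suc) (otherLeaders σ)
      ≡⟨ cong (cycleFrom π zero ∷_) (List.map-cong-local (All.tabulate λ {k} k∈ → cycleFrom-punchIn k (leader-avoids-0 k k∈))) ⟩
    cycleFrom π zero ∷ map (map pI ∘ cycleFrom σ ∘ suc) (otherLeaders σ)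
      ≡⟨ cong (cycleFrom π zero ∷_) (List.map-∘ (otherLeaders σ)) ⟩
    cycleFrom π zero ∷ map (map pI) (otherCycles σ)  ∎)
    where
    open ≡-Reasoning
    leader-avoids-0 : ∀ k → k ∈ otherLeaders σ → ¬ zero ∈ cycleFrom σ (suc k)
    leader-avoids-0 k k∈ 0∈ = case trans (sym (∈-boolFilter⁻ (isLeader σ ∘ suc) (allFin m) k∈)) (isLeader-false σ k 0∈) of λ ()

  flatTail-insert : flatTail π ≡ suc p ∷ map pI (flatTail σ)
  flatTail-insert = begin
    cycleTail π zero (suc (suc m)) (lookup π zero) ++ concat (otherCycles π)
      ≡⟨ cong₂ _++_ (List.∷-injectiveʳ cycleFrom-zero) (cong concat otherCycles-insert) ⟩
    suc p ∷ map pI (cycleTail σ zero (suc m) (lookup σ zero)) ++ concat (map (map pI) (otherCycles σ))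
      ≡⟨ cong (λ l → suc p ∷ map pI (cycleTail σ zero (suc m) (lookup σ zero)) ++ l) (List.concat-map (otherCycles σ)) ⟩
    suc p ∷ map pI (cycleTail σ zero (suc m) (lookup σ zero)) ++ map pI (concat (otherCycles σ))
      ≡⟨ cong (suc p ∷_) (sym (List.map-++ pI _ (concat (otherCycles σ)))) ⟩
    suc p ∷ map pI (flatTail σ) ∎
    where open ≡-Reasoning

  μ-insert : μ π ≡ μ σ
  μ-insert = begin
    μ π                                       ≡⟨ μ-otherCycles π ⟩
    suc (length (otherCycles π))              ≡⟨ cong (suc ∘ length) otherCycles-insert ⟩
    suc (length (map (map pI) (otherCycles σ))) ≡⟨ cong suc (List.length-map (map pI) (otherCycles σ)) ⟩
    suc (length (otherCycles σ))              ≡⟨ sym (μ-otherCycles σ) ⟩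
    μ σ ∎
    where open ≡-Reasoning

module FixedCycles {m} (τ : Perm m) (inj : IsPerm τ) where

  open Transport {σ = τ} {π = fixZero τ} Fin.suc-injective (λ _ → ⊤) (λ j _ → fixZero-suc τ j)

  cycleFrom-suc : ∀ k → cycleFrom (fixZero τ) (suc k) ≡ map suc (cycleFrom τ k)
  cycleFrom-suc k with orbit-returns inj k
  ... | d , d<m , returns = cong (suc k ∷_) (begin
    cycleTail (fixZero τ) (suc k) (suc m) (lookup (fixZero τ) (suc k)) ≡⟨ cong (cycleTail (fixZero τ) (suc k) (suc m)) (fixZero-suc τ k) ⟩
    cycleTail (fixZero τ) (suc k) (suc m) (suc (lookup τ k))           ≡⟨ cycleTail-map k (suc m) (lookup τ k) (All.universal _ _) ⟩
    map suc (cycleTail τ k (suc m) (lookup τ k))                       ≡⟨ cong (map suc) (cycleTail-fuel τ k d (lookup τ k) returns (ℕ.m≤n⇒m≤1+n d<m) d<m) ⟩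
    map suc (cycleTail τ k m (lookup τ k))                             ∎)
    where open ≡-Reasoning

  otherLeaders-fixZero : otherLeaders (fixZero τ) ≡ leaders τ
  otherLeaders-fixZero = boolFilter-cong _ _ (allFin m)
    (λ k _ → isLeader-map suc (λ a b → ≤ᵇ-suc (toℕ a) (toℕ b)) k (cycleFrom-suc k))

  otherCycles-fixZero : otherCycles (fixZero τ) ≡ map (map suc) (cycles τ)
  otherCycles-fixZero = begin
    map (cycleFrom (fixZero τ) ∘ suc) (otherLeaders (fixZero τ)) ≡⟨ cong (map (cycleFrom (fixZero τ) ∘ suc)) otherLeaders-fixZero ⟩
    map (cycleFrom (fixZero τ) ∘ suc) (leaders τ)                ≡⟨ List.map-cong cycleFrom-suc (leaders τ) ⟩
    map (map suc ∘ cycleFrom τ) (leaders τ)                      ≡⟨ List.map-∘ (leaders τ) ⟩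
    map (map suc) (cycles τ)                                     ∎
    where open ≡-Reasoning

  flatTail-fixZero : flatTail (fixZero τ) ≡ map suc (concat (cycles τ))
  flatTail-fixZero = trans (cong concat otherCycles-fixZero) (List.concat-map (cycles τ))

  μ-fixZero : μ (fixZero τ) ≡ suc (μ τ)
  μ-fixZero = begin
    μ (fixZero τ)                              ≡⟨ μ-otherCycles (fixZero τ) ⟩
    suc (length (otherCycles (fixZero τ)))     ≡⟨ cong (suc ∘ length) otherCycles-fixZero ⟩
    suc (length (map (map suc) (cycles τ)))    ≡⟨ cong suc (List.length-map (map suc) (cycles τ)) ⟩
    suc (length (cycles τ))                    ≡⟨ cong suc (sym (μ-cycles τ)) ⟩
    suc (μ τ)                                  ∎
    where open ≡-Reasoning

∈-concat-fixZero : ∀ {m} (τ : Perm m) → IsPerm τ → (∀ y → y ∈ concat (cycles τ)) → ∀ x → x ∈ concat (cycles (fixZero τ))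
∈-concat-fixZero τ inj complete x = subst (x ∈_) (sym concat-fixZero) (member x)
  where
  concat-fixZero : concat (cycles (fixZero τ)) ≡ zero ∷ map suc (concat (cycles τ))
  concat-fixZero = trans (concat-cycles-suc (fixZero τ)) (cong (zero ∷_) (FixedCycles.flatTail-fixZero τ inj))
  member : ∀ x → x ∈ zero ∷ map suc (concat (cycles τ))
  member zero    = here refl
  member (suc y) = there (∈-map⁺ suc (complete y))

∈-concat-insert : ∀ {m} p (σ : Perm (suc m)) → IsPerm σ → (∀ y → y ∈ concat (cycles σ)) →
  ∀ x → x ∈ concat (cycles (insertAfterZero p σ))
∈-concat-insert p σ inj complete x = subst (x ∈_) (sym concat-insert) (member (position p x))
  where
  concat-insert : concat (cycles (insertAfterZero p σ)) ≡ zero ∷ suc p ∷ map (punchIn (suc p)) (flatTail σ)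
  concat-insert = trans (concat-cycles-suc (insertAfterZero p σ)) (cong (zero ∷_) (InsertedCycles.flatTail-insert p σ inj))
  member : ∀ {x} → Position p x → x ∈ zero ∷ suc p ∷ map (punchIn (suc p)) (flatTail σ)
  member atZero      = here refl
  member atTarget    = there (here refl)
  member (atOther k) with subst (suc k ∈_) (concat-cycles-suc σ) (complete (suc k))
  ... | there k∈ = there (there (∈-map⁺ (punchIn (suc p)) k∈))

∈-concat-cycles : ∀ {n} (σ : Perm n) → IsPerm σ → ∀ x → x ∈ concat (cycles σ)
∈-concat-cycles {suc _} σ inj x with zeroView σ inj
... | fixed τ τ-perm         = ∈-concat-fixZero τ τ-perm (∈-concat-cycles τ τ-perm) x
... | inserted p σ′ σ′-perm = ∈-concat-insert p σ′ σ′-perm (∈-concat-cycles σ′ σ′-perm) x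

-- Derangements and the pattern 31-2

flatTail-nonFixed : ∀ {m} (σ : Perm (suc m)) → lookup σ zero ≢ zero → ∃ λ rest → flatTail σ ≡ lookup σ zero ∷ rest
flatTail-nonFixed σ σ0≢0 with lookup σ zero ≟ᶠ zero
... | yes σ0≡0 = ⊥-elim (σ0≢0 σ0≡0)
... | no _     = _ , refl

secondLetter-nonFixed : ∀ {m} (σ : Perm (suc m)) → lookup σ zero ≢ zero → ∀ i → secondLetterIs i (flat σ) ≡ (label (lookup σ zero) ≡ᵇ i)
secondLetter-nonFixed σ σ0≢0 i with flatTail-nonFixed σ σ0≢0
... | rest , tail≡ rewrite flat-flatTail σ | tail≡ = refl

module _ {n} (σ : Perm n) where

  isDerangement⇒ : T (isDerangement σ) → ∀ x → lookup σ x ≢ x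
  isDerangement⇒ der x σx≡x with lookup σ x ≟ᶠ x | All.lookup (all⁺ _ (allFin n) der) (∈-allFin x)
  ... | yes _   | ()
  ... | no σx≢x | _ = σx≢x σx≡x

  isDerangement⇐ : (∀ x → lookup σ x ≢ x) → T (isDerangement σ)
  isDerangement⇐ no-fixed = all⁻ _ (All.universal notFixed (allFin n))
    where
    notFixed : ∀ x → T (not (does (lookup σ x ≟ᶠ x)))
    notFixed x with lookup σ x ≟ᶠ x
    ... | yes σx≡x = no-fixed x σx≡x
    ... | no _     = _

module _ {m} (p : Fin (suc m)) (σ : Perm (suc m)) where

  isDerangement-insert⇔ : T (isDerangement (insertAfterZero p σ)) ⇔ (∀ k → lookup σ (suc k) ≢ suc k)
  isDerangement-insert⇔ = mk⇔ to from
    where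
    to : T (isDerangement (insertAfterZero p σ)) → ∀ k → lookup σ (suc k) ≢ suc k
    to der k σk≡k = isDerangement⇒ (insertAfterZero p σ) der (punchIn (suc p) (suc k))
      (trans (insertAfterZero-other p σ k) (cong (punchIn (suc p)) σk≡k))
    from : (∀ k → lookup σ (suc k) ≢ suc k) → T (isDerangement (insertAfterZero p σ))
    from no-fixed = isDerangement⇐ (insertAfterZero p σ) notFixed
      where
      notFixed : ∀ x → lookup (insertAfterZero p σ) x ≢ x
      notFixed x with position p x
      ... | atZero    = λ e → Fin.0≢1+n (trans (sym e) (insertAfterZero-zero p σ))
      ... | atTarget  = λ e → Fin.punchInᵢ≢i (suc p) _ (trans (sym (insertAfterZero-target p σ)) e)
      ... | atOther k = λ e → no-fixed k (Fin.punchIn-injective (suc p) _ _ (trans (sym (insertAfterZero-other p σ k)) e))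

  isDerangement-insert : lookup σ zero ≢ zero → isDerangement (insertAfterZero p σ) ≡ isDerangement σ
  isDerangement-insert σ0≢0 = T-ext
    (λ der → isDerangement⇐ σ λ { zero → σ0≢0 ; (suc k) → Equivalence.to isDerangement-insert⇔ der k })
    (λ der → Equivalence.from isDerangement-insert⇔ (λ k → isDerangement⇒ σ der (suc k)))

isDerangement-insert-fixZero : ∀ {m} (p : Fin (suc m)) (τ : Perm m) → isDerangement (insertAfterZero p (fixZero τ)) ≡ isDerangement τ
isDerangement-insert-fixZero p τ = T-ext
  (λ der → isDerangement⇐ τ λ k τk≡k → Equivalence.to inserted⇔ der k (trans (fixZero-suc τ k) (cong suc τk≡k)))
  (λ der → Equivalence.from inserted⇔ λ k e → isDerangement⇒ τ der k (Fin.suc-injective (trans (sym (fixZero-suc τ k)) e)))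
  where
  inserted⇔ : T (isDerangement (insertAfterZero p (fixZero τ))) ⇔ (∀ k → lookup (fixZero τ) (suc k) ≢ suc k)
  inserted⇔ = isDerangement-insert⇔ p (fixZero τ)

contains31-2-1∷ : ∀ w → contains31-2 (1 ∷ w) ≡ contains31-2 w
contains31-2-1∷ []      = refl
contains31-2-1∷ (b ∷ w) = cong (_∨ contains31-2 (b ∷ w)) (none w)
  where
  none : ∀ w → any (λ c → (b <ᵇ c) ∧ (c <ᵇ 1)) w ≡ false
  none []            = refl
  none (zero  ∷ w)   = none w
  none (suc c ∷ w) rewrite ∧-zeroʳ (b <ᵇ suc c) = none w

contains31-2-relabel : ∀ {A : Set} (g h : A → ℕ) → (∀ a b → (g a <ᵇ g b) ≡ (h a <ᵇ h b)) →
  ∀ w → contains31-2 (map g w) ≡ contains31-2 (map h w)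
contains31-2-relabel g h same []          = refl
contains31-2-relabel g h same (a ∷ [])     = refl
contains31-2-relabel g h same (a ∷ b ∷ w) = cong₂ _∨_ between (contains31-2-relabel g h same (b ∷ w))
  where
  between : any (λ c → (g b <ᵇ c) ∧ (c <ᵇ g a)) (map g w) ≡ any (λ c → (h b <ᵇ c) ∧ (c <ᵇ h a)) (map h w)
  between = cong or (trans (sym (List.map-∘ w)) (trans (List.map-cong (λ c → cong₂ _∧_ (same b c) (same c a)) w) (List.map-∘ w)))

-- Whether q u U has an occurrence of 31-2 whose first letter is q, with U not yet relabelled by punchIn q.
startsPattern31-2 : ∀ {m} → Fin (suc m) → List (Fin m) → Bool
startsPattern31-2 q []      = false
startsPattern31-2 q (u ∷ U) = any (λ c → (toℕ u <ᵇ toℕ c) ∧ (toℕ c <ᵇ toℕ q)) U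

contains31-2-punchIn : ∀ {m} (q : Fin (suc m)) U →
  contains31-2 (1 ∷ label q ∷ map (label ∘ punchIn q) U) ≡ (startsPattern31-2 q U ∨ contains31-2 (1 ∷ map label U))
contains31-2-punchIn q U =
  trans (contains31-2-1∷ (label q ∷ map (label ∘ punchIn q) U))
        (trans (after-q U) (cong (startsPattern31-2 q U ∨_) (sym (contains31-2-1∷ (map label U)))))
  where
  after-q : ∀ U → contains31-2 (label q ∷ map (label ∘ punchIn q) U) ≡ (startsPattern31-2 q U ∨ contains31-2 (map label U))
  after-q []      = refl
  after-q (u ∷ U) = cong₂ _∨_
    (cong or (trans (sym (List.map-∘ U)) (List.map-cong (λ c → cong₂ _∧_ (punchIn-<ᵇ q u c) (punchIn-<ᵇ-self q c)) U)))
    (contains31-2-relabel (label ∘ punchIn q) label (λ a b → punchIn-<ᵇ q a b) (u ∷ U))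

startsPattern31-2-complete : ∀ {m} (q : Fin (suc (suc m))) u U → (∀ x → x ∈ zero ∷ u ∷ U) →
  startsPattern31-2 q (u ∷ U) ≡ (suc (toℕ u) <ᵇ toℕ q)
startsPattern31-2-complete {m} q u U complete = T-ext to from
  where
  to : T (startsPattern31-2 q (u ∷ U)) → T (suc (toℕ u) <ᵇ toℕ q)
  to d with Any.satisfied (any⁻ _ U d)
  ... | c , u<c<q with Equivalence.to (T-∧ {toℕ u <ᵇ toℕ c}) u<c<q
  ...   | u<c , c<q = ℕ.<⇒<ᵇ (ℕ.≤-<-trans (ℕ.<ᵇ⇒< (toℕ u) (toℕ c) u<c) (ℕ.<ᵇ⇒< (toℕ c) (toℕ q) c<q))
  from : T (suc (toℕ u) <ᵇ toℕ q) → T (startsPattern31-2 q (u ∷ U))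
  from su<q = any⁺ _ (Any.map (λ { refl → Equivalence.from T-∧ (ℕ.<⇒<ᵇ u<next , ℕ.<⇒<ᵇ next<q) }) next∈U)
    where
    su<sm : suc (toℕ u) < suc m
    su<sm = ℕ.≤-trans (ℕ.<ᵇ⇒< _ _ su<q) (ℕ.≤-pred (Fin.toℕ<n q))
    next : Fin (suc m)
    next = fromℕ< su<sm
    toℕ-next : toℕ next ≡ suc (toℕ u)
    toℕ-next = Fin.toℕ-fromℕ< su<sm
    u<next : toℕ u < toℕ next
    u<next = ℕ.≤-reflexive (sym toℕ-next)
    next<q : toℕ next < toℕ q
    next<q = subst (_< toℕ q) (sym toℕ-next) (ℕ.<ᵇ⇒< _ _ su<q)
    next∈U : next ∈ U
    next∈U with complete next
    ... | here next≡0         = ⊥-elim (ℕ.0≢1+n (trans (sym (cong toℕ next≡0)) toℕ-next))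
    ... | there (here next≡u) = ⊥-elim (ℕ.1+n≢n (sym (trans (sym (cong toℕ next≡u)) toℕ-next)))
    ... | there (there next∈) = next∈

startsPattern31-2-flatTail : ∀ {m} (q : Fin (suc (suc m))) (σ : Perm (suc m)) → IsPerm σ →
  ∀ {u U} → flatTail σ ≡ u ∷ U → startsPattern31-2 q (flatTail σ) ≡ (suc (toℕ u) <ᵇ toℕ q)
startsPattern31-2-flatTail q σ inj {u} {U} tail≡ rewrite tail≡ =
  startsPattern31-2-complete q u U (λ x → subst (x ∈_) (trans (concat-cycles-suc σ) (cong (zero ∷_) tail≡)) (∈-concat-cycles σ inj x))

contains31-2-insert : ∀ {m} (p : Fin (suc m)) (σ : Perm (suc m)) → IsPerm σ →
  contains31-2 (flat (insertAfterZero p σ)) ≡ (startsPattern31-2 (suc p) (flatTail σ) ∨ contains31-2 (flat σ))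
contains31-2-insert p σ inj = begin
  contains31-2 (flat (insertAfterZero p σ))
    ≡⟨ cong contains31-2 (trans (flat-flatTail (insertAfterZero p σ)) (cong (λ w → 1 ∷ map label w) (InsertedCycles.flatTail-insert p σ inj))) ⟩
  contains31-2 (1 ∷ label (suc p) ∷ map label (map (punchIn (suc p)) (flatTail σ)))
    ≡⟨ cong (λ w → contains31-2 (1 ∷ label (suc p) ∷ w)) (sym (List.map-∘ (flatTail σ))) ⟩
  contains31-2 (1 ∷ label (suc p) ∷ map (label ∘ punchIn (suc p)) (flatTail σ))
    ≡⟨ contains31-2-punchIn (suc p) (flatTail σ) ⟩
  startsPattern31-2 (suc p) (flatTail σ) ∨ contains31-2 (1 ∷ map label (flatTail σ))
    ≡⟨ cong (λ w → startsPattern31-2 (suc p) (flatTail σ) ∨ contains31-2 w) (sym (flat-flatTail σ)) ⟩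
  startsPattern31-2 (suc p) (flatTail σ) ∨ contains31-2 (flat σ) ∎
  where open ≡-Reasoning

inD31-2 : ∀ {n} → Perm n → Bool
inD31-2 σ = isDerangement σ ∧ not (contains31-2 (flat σ))

inD31-2-nonFixed : ∀ {m} (σ : Perm (suc m)) → inD31-2 σ ≡ true → lookup σ zero ≢ zero
inD31-2-nonFixed σ good = isDerangement⇒ σ (proj₁ (Equivalence.to T-∧ (Equivalence.from T-≡ good))) zero

inD31-2-insert : ∀ {m} (p : Fin (suc m)) (σ : Perm (suc m)) → IsPerm σ → lookup σ zero ≢ zero →
  inD31-2 (insertAfterZero p σ) ≡ (inD31-2 σ ∧ (toℕ p ≤ᵇ toℕ (lookup σ zero)))
inD31-2-insert p σ inj σ0≢0 = begin
  isDerangement (insertAfterZero p σ) ∧ not (contains31-2 (flat (insertAfterZero p σ)))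
    ≡⟨ cong₂ (λ d c → d ∧ not c) (isDerangement-insert p σ σ0≢0) (contains31-2-insert p σ inj) ⟩
  isDerangement σ ∧ not (startsPattern31-2 (suc p) (flatTail σ) ∨ contains31-2 (flat σ))
    ≡⟨ ∧-not-∨ (isDerangement σ) _ _ ⟩
  inD31-2 σ ∧ not (startsPattern31-2 (suc p) (flatTail σ))
    ≡⟨ cong (λ b → inD31-2 σ ∧ not b) (startsPattern31-2-flatTail (suc p) σ inj (proj₂ (flatTail-nonFixed σ σ0≢0))) ⟩
  inD31-2 σ ∧ not (toℕ (lookup σ zero) <ᵇ toℕ p)
    ≡⟨ cong (inD31-2 σ ∧_) (not-<ᵇ (toℕ (lookup σ zero)) (toℕ p)) ⟩
  inD31-2 σ ∧ (toℕ p ≤ᵇ toℕ (lookup σ zero)) ∎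
  where open ≡-Reasoning

contains31-2-fixZero : ∀ {m} (τ : Perm m) → IsPerm τ → contains31-2 (flat (fixZero τ)) ≡ contains31-2 (flat τ)
contains31-2-fixZero τ inj = begin
  contains31-2 (flat (fixZero τ))
    ≡⟨ cong contains31-2 (trans (flat-flatTail (fixZero τ)) (cong (λ w → 1 ∷ map label w) (FixedCycles.flatTail-fixZero τ inj))) ⟩
  contains31-2 (1 ∷ map label (map suc (concat (cycles τ))))
    ≡⟨ contains31-2-1∷ (map label (map suc (concat (cycles τ)))) ⟩
  contains31-2 (map label (map suc (concat (cycles τ))))
    ≡⟨ cong contains31-2 (sym (List.map-∘ (concat (cycles τ)))) ⟩
  contains31-2 (map (label ∘ suc) (concat (cycles τ)))
    ≡⟨ contains31-2-relabel (label ∘ suc) label (λ _ _ → refl) (concat (cycles τ)) ⟩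
  contains31-2 (map label (concat (cycles τ)))
    ≡⟨ cong contains31-2 (sym (flat-cycles τ)) ⟩
  contains31-2 (flat τ) ∎
  where open ≡-Reasoning

startsPattern31-2-fixZero : ∀ {m} (p : Fin (suc m)) (τ : Perm m) → IsPerm τ → startsPattern31-2 (suc p) (flatTail (fixZero τ)) ≡ (1 <ᵇ toℕ p)
startsPattern31-2-fixZero {zero}  zero τ inj = refl
startsPattern31-2-fixZero {suc m} p    τ inj = startsPattern31-2-flatTail (suc p) (fixZero τ) (fixZero-isPerm inj)
  (trans (FixedCycles.flatTail-fixZero τ inj) (cong (map suc) (concat-cycles-suc τ)))

inD31-2-insert-fixZero : ∀ {m} (p : Fin (suc m)) (τ : Perm m) → IsPerm τ →
  inD31-2 (insertAfterZero p (fixZero τ)) ≡ (inD31-2 τ ∧ (toℕ p ≤ᵇ 1))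
inD31-2-insert-fixZero p τ inj = begin
  isDerangement (insertAfterZero p (fixZero τ)) ∧ not (contains31-2 (flat (insertAfterZero p (fixZero τ))))
    ≡⟨ cong₂ (λ d c → d ∧ not c) (isDerangement-insert-fixZero p τ) (contains31-2-insert p (fixZero τ) (fixZero-isPerm inj)) ⟩
  isDerangement τ ∧ not (startsPattern31-2 (suc p) (flatTail (fixZero τ)) ∨ contains31-2 (flat (fixZero τ)))
    ≡⟨ cong₂ (λ x c → isDerangement τ ∧ not (x ∨ c)) (startsPattern31-2-fixZero p τ inj) (contains31-2-fixZero τ inj) ⟩
  isDerangement τ ∧ not ((1 <ᵇ toℕ p) ∨ contains31-2 (flat τ))
    ≡⟨ ∧-not-∨ (isDerangement τ) _ _ ⟩
  inD31-2 τ ∧ not (1 <ᵇ toℕ p)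
    ≡⟨ cong (inD31-2 τ ∧_) (not-<ᵇ 1 (toℕ p)) ⟩
  inD31-2 τ ∧ (toℕ p ≤ᵇ 1) ∎
  where open ≡-Reasoning

module WeightedSums {c ℓ} (R : CommutativeSemiring c ℓ) where

  open CommutativeSemiring R hiding (zero) renaming (refl to ≈-refl; sym to ≈-sym; trans to ≈-trans)
  open Poly R using (sumR; rangeSum)
  open import Relation.Binary.Reasoning.Setoid setoid
  open import Data.List.Relation.Binary.Permutation.Setoid.Properties setoid using (foldr-commMonoid)
  open import Data.List.Relation.Binary.Permutation.Propositional using (↭⇒↭ₛ′)
  import Data.List.Relation.Binary.Permutation.Propositional.Properties as Perm

  sumWhere : {A : Set} → List A → (A → Bool) → (A → Carrier) → Carrier
  sumWhere xs b w = sumR (map (λ x → if b x then w x else 0#) xs)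

  sumR-↭ : ∀ {xs ys} → xs ↭ ys → sumR xs ≈ sumR ys
  sumR-↭ xs↭ys = foldr-commMonoid +-isCommutativeMonoid (↭⇒↭ₛ′ isEquivalence xs↭ys)

  sumR-map-↭ : {A : Set} (w : A → Carrier) {xs ys : List A} → xs ↭ ys → sumR (map w xs) ≈ sumR (map w ys)
  sumR-map-↭ w xs↭ys = sumR-↭ (Perm.map⁺ w xs↭ys)

  sumR-map-cong : {A : Set} {f g : A → Carrier} (xs : List A) → (∀ x → x ∈ xs → f x ≈ g x) → sumR (map f xs) ≈ sumR (map g xs)
  sumR-map-cong []       _   = ≈-refl
  sumR-map-cong (x ∷ xs) f≈g = +-cong (f≈g x (here refl)) (sumR-map-cong xs (λ z z∈ → f≈g z (there z∈)))

  sumR-map-+ : {A : Set} (f g : A → Carrier) (xs : List A) → sumR (map (λ x → f x + g x) xs) ≈ sumR (map f xs) + sumR (map g xs)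
  sumR-map-+ f g []       = ≈-sym (+-identityˡ 0#)
  sumR-map-+ f g (x ∷ xs) = begin
    (f x + g x) + sumR (map (λ x → f x + g x) xs) ≈⟨ +-congˡ (sumR-map-+ f g xs) ⟩
    (f x + g x) + (F + G)                          ≈⟨ +-assoc (f x) (g x) (F + G) ⟩
    f x + (g x + (F + G))                          ≈⟨ +-congˡ (≈-sym (+-assoc (g x) F G)) ⟩
    f x + ((g x + F) + G)                          ≈⟨ +-congˡ (+-congʳ (+-comm (g x) F)) ⟩
    f x + ((F + g x) + G)                          ≈⟨ +-congˡ (+-assoc F (g x) G) ⟩
    f x + (F + (g x + G))                          ≈⟨ ≈-sym (+-assoc (f x) F (g x + G)) ⟩
    (f x + F) + (g x + G)                          ∎
    where
    F G : Carrier
    F = sumR (map f xs)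
    G = sumR (map g xs)

  sumR-map-*ˡ : {A : Set} (a : Carrier) (f : A → Carrier) (xs : List A) → sumR (map (λ x → a * f x) xs) ≈ a * sumR (map f xs)
  sumR-map-*ˡ a f []       = ≈-sym (zeroʳ a)
  sumR-map-*ˡ a f (x ∷ xs) = ≈-trans (+-congˡ (sumR-map-*ˡ a f xs)) (≈-sym (distribˡ a (f x) (sumR (map f xs))))

  sumR-filter : {A : Set} {P : A → Set} (P? : ∀ x → Dec (P x)) (w : A → Carrier) (xs : List A) →
                sumR (map w (filter P? xs)) ≈ sumWhere xs (does ∘ P?) w
  sumR-filter P? w []       = ≈-refl
  sumR-filter P? w (x ∷ xs) with does (P? x)
  ... | true  = +-congˡ (sumR-filter P? w xs)
  ... | false = ≈-trans (sumR-filter P? w xs) (≈-sym (+-identityˡ _))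

  sumR-boolFilter : {A : Set} (b : A → Bool) (w : A → Carrier) (xs : List A) → sumR (map w (boolFilter b xs)) ≈ sumWhere xs b w
  sumR-boolFilter b w []       = ≈-refl
  sumR-boolFilter b w (x ∷ xs) with b x
  ... | true  = +-congˡ (sumR-boolFilter b w xs)
  ... | false = ≈-trans (sumR-boolFilter b w xs) (≈-sym (+-identityˡ _))

  sumWhere-boolFilter : {A : Set} (b c : A → Bool) (w : A → Carrier) (xs : List A) →
                        sumWhere (boolFilter b xs) c w ≈ sumWhere xs (λ x → b x ∧ c x) w
  sumWhere-boolFilter b c w []       = ≈-refl
  sumWhere-boolFilter b c w (x ∷ xs) with b x
  ... | true  = +-congˡ (sumWhere-boolFilter b c w xs)
  ... | false = ≈-trans (sumWhere-boolFilter b c w xs) (≈-sym (+-identityˡ _))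

  sumWhere-cong : {A : Set} {b c : A → Bool} {w v : A → Carrier} (xs : List A) →
                  (∀ x → x ∈ xs → b x ≡ c x) → (∀ x → x ∈ xs → w x ≈ v x) → sumWhere xs b w ≈ sumWhere xs c v
  sumWhere-cong {b = b} {c} {w} {v} xs b≡c w≈v = sumR-map-cong xs term
    where
    term : ∀ x → x ∈ xs → (if b x then w x else 0#) ≈ (if c x then v x else 0#)
    term x x∈ rewrite b≡c x x∈ with c x
    ... | true  = w≈v x x∈
    ... | false = ≈-refl

  sumWhere-false : {A : Set} {b : A → Bool} (w : A → Carrier) (xs : List A) → (∀ x → x ∈ xs → b x ≡ false) → sumWhere xs b w ≈ 0#
  sumWhere-false w [] _ = ≈-refl
  sumWhere-false {b = b} w (x ∷ xs) none rewrite none x (here refl) =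
    ≈-trans (+-identityˡ _) (sumWhere-false w xs (λ z z∈ → none z (there z∈)))

  sumWhere-∧-true : {A : Set} (b : A → Bool) (w : A → Carrier) (xs : List A) → sumWhere xs (λ x → b x ∧ true) w ≈ sumWhere xs b w
  sumWhere-∧-true b w xs = sumWhere-cong xs (λ x _ → ∧-identityʳ (b x)) (λ _ _ → ≈-refl)

  sumWhere-*ˡ : {A : Set} (a : Carrier) (b : A → Bool) (w : A → Carrier) (xs : List A) →
                sumWhere xs b (λ x → a * w x) ≈ a * sumWhere xs b w
  sumWhere-*ˡ a b w xs = ≈-trans (sumR-map-cong xs (λ x _ → term x)) (sumR-map-*ˡ a (λ x → if b x then w x else 0#) xs)
    where
    term : ∀ x → (if b x then a * w x else 0#) ≈ a * (if b x then w x else 0#)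
    term x with b x
    ... | true  = ≈-refl
    ... | false = ≈-sym (zeroʳ a)

  if-cong : {b c : Bool} {w v : Carrier} → b ≡ c → w ≈ v → (if b then w else 0#) ≈ (if c then v else 0#)
  if-cong {true}  refl w≈v = w≈v
  if-cong {false} refl _   = ≈-refl

  if-∨ : (c e g : Bool) (w : Carrier) → (e ∧ g) ≡ false →
         (if c ∧ (e ∨ g) then w else 0#) ≈ (if c ∧ e then w else 0#) + (if c ∧ g then w else 0#)
  if-∨ false e     g     w _ = ≈-sym (+-identityˡ 0#)
  if-∨ true  true  false w _ = ≈-sym (+-identityʳ w)
  if-∨ true  false true  w _ = ≈-sym (+-identityˡ w)
  if-∨ true  false false w _ = ≈-sym (+-identityˡ 0#)

  sumR-applyUpTo-cong : {f g : ℕ → Carrier} (n : ℕ) → (∀ t → f t ≈ g t) → sumR (applyUpTo f n) ≈ sumR (applyUpTo g n)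
  sumR-applyUpTo-cong zero    _   = ≈-refl
  sumR-applyUpTo-cong (suc n) f≈g = +-cong (f≈g 0) (sumR-applyUpTo-cong n (f≈g ∘ suc))

  module _ {A : Set} (b : A → Bool) (s : A → ℕ) (w : A → Carrier) (xs : List A) where

    private
      atValue : ℕ → Carrier
      atValue k = sumWhere xs (λ x → b x ∧ (s x ≡ᵇ k)) w

    sumWhere-≤ᵇ-applyUpTo : ∀ count lo → (∀ x → x ∈ xs → s x < lo ℕ.+ count) →
      sumWhere xs (λ x → b x ∧ (lo ≤ᵇ s x)) w ≈ sumR (applyUpTo (λ t → atValue (lo ℕ.+ t)) count)
    sumWhere-≤ᵇ-applyUpTo zero lo below = sumWhere-false w xs λ x x∈ →
      trans (cong (b x ∧_) (≤ᵇ-false lo (s x) (subst (s x <_) (ℕ.+-identityʳ lo) (below x x∈)))) (∧-zeroʳ (b x))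
    sumWhere-≤ᵇ-applyUpTo (suc count) lo below = begin
      sumWhere xs (λ x → b x ∧ (lo ≤ᵇ s x)) w
        ≈⟨ sumR-map-cong xs (λ x _ → split x) ⟩
      sumR (map (λ x → (if b x ∧ (s x ≡ᵇ lo) then w x else 0#) + (if b x ∧ (suc lo ≤ᵇ s x) then w x else 0#)) xs)
        ≈⟨ sumR-map-+ _ _ xs ⟩
      atValue lo + sumWhere xs (λ x → b x ∧ (suc lo ≤ᵇ s x)) w
        ≈⟨ +-cong (reflexive (cong atValue (sym (ℕ.+-identityʳ lo)))) (sumWhere-≤ᵇ-applyUpTo count (suc lo) below′) ⟩
      atValue (lo ℕ.+ 0) + sumR (applyUpTo (λ t → atValue (suc lo ℕ.+ t)) count)
        ≈⟨ +-congˡ (sumR-applyUpTo-cong count (λ t → reflexive (cong atValue (sym (ℕ.+-suc lo t))))) ⟩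
      sumR (applyUpTo (λ t → atValue (lo ℕ.+ t)) (suc count)) ∎
      where
      split : ∀ x → (if b x ∧ (lo ≤ᵇ s x) then w x else 0#) ≈
                    (if b x ∧ (s x ≡ᵇ lo) then w x else 0#) + (if b x ∧ (suc lo ≤ᵇ s x) then w x else 0#)
      split x = ≈-trans (reflexive (cong (λ c → if b x ∧ c then w x else 0#) (≤ᵇ-split lo (s x))))
                        (if-∨ (b x) _ _ (w x) (≡ᵇ-∧-≤ᵇ lo (s x)))
      below′ : ∀ x → x ∈ xs → s x < suc lo ℕ.+ count
      below′ x x∈ = subst (s x <_) (ℕ.+-suc lo count) (below x x∈)

    sumWhere-≤ᵇ-rangeSum : ∀ lo hi → lo ≤ suc hi → (∀ x → x ∈ xs → s x ≤ hi) →
      sumWhere xs (λ x → b x ∧ (lo ≤ᵇ s x)) w ≈ rangeSum atValue lo hi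
    sumWhere-≤ᵇ-rangeSum lo hi lo≤ bounded = begin
      sumWhere xs (λ x → b x ∧ (lo ≤ᵇ s x)) w
        ≈⟨ sumWhere-≤ᵇ-applyUpTo (suc hi ∸ lo) lo (λ x x∈ → subst (s x <_) (sym (ℕ.m+[n∸m]≡n lo≤)) (s≤s (bounded x x∈))) ⟩
      sumR (applyUpTo (λ t → atValue (lo ℕ.+ t)) (suc hi ∸ lo))
        ≡⟨ cong sumR (sym (List.map-upTo (λ t → atValue (lo ℕ.+ t)) (suc hi ∸ lo))) ⟩
      rangeSum atValue lo hi ∎

  rangeSum-cong : {f g : ℕ → Carrier} → (∀ k → f k ≈ g k) → ∀ lo hi → rangeSum f lo hi ≈ rangeSum g lo hi
  rangeSum-cong f≈g lo hi = sumR-map-cong (upTo (suc hi ∸ lo)) (λ t _ → f≈g (lo ℕ.+ t))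

-- Counting

module Counting {c ℓ} (R : CommutativeSemiring c ℓ) (y : CommutativeSemiring.Carrier R) where

  open CommutativeSemiring R hiding (zero) renaming (refl to ≈-refl; sym to ≈-sym; trans to ≈-trans)
  open Poly R
  open WeightedSums R
  open import Relation.Binary.Reasoning.Setoid setoid

  weight : ∀ {n} → Perm n → Carrier
  weight σ = pow y (μ σ)

  contribution : ∀ {n} → Perm n → Carrier
  contribution π = if inD31-2 π then weight π else 0#

  a-sumWhere : ∀ n → a y n ≈ sumWhere (perms n) inD31-2 weight
  a-sumWhere n = sumR-boolFilter inD31-2 weight (perms n)

  a2-sumWhere : ∀ m i → a2 y (suc m) i ≈ sumWhere (perms (suc m)) (λ σ → inD31-2 σ ∧ (label (lookup σ zero) ≡ᵇ i)) weight
  a2-sumWhere m i = begin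
    a2 y (suc m) i
      ≈⟨ sumR-boolFilter (λ σ → secondLetterIs i (flat σ)) weight (boolFilter inD31-2 (perms (suc m))) ⟩
    sumWhere (boolFilter inD31-2 (perms (suc m))) (λ σ → secondLetterIs i (flat σ)) weight
      ≈⟨ sumWhere-boolFilter inD31-2 _ weight (perms (suc m)) ⟩
    sumWhere (perms (suc m)) (λ σ → inD31-2 σ ∧ secondLetterIs i (flat σ)) weight
      ≈⟨ sumWhere-cong (perms (suc m)) (λ σ _ → secondLetter σ) (λ _ _ → ≈-refl) ⟩
    sumWhere (perms (suc m)) (λ σ → inD31-2 σ ∧ (label (lookup σ zero) ≡ᵇ i)) weight ∎
    where
    secondLetter : ∀ σ → (inD31-2 σ ∧ secondLetterIs i (flat σ)) ≡ (inD31-2 σ ∧ (label (lookup σ zero) ≡ᵇ i))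
    secondLetter σ with inD31-2 σ in good
    ... | false = refl
    ... | true  = secondLetter-nonFixed σ (inD31-2-nonFixed σ good) i

  module _ {m} (p : Fin (suc m)) where

    private
      nonFixedPart : Perm (suc m) → Carrier
      nonFixedPart σ = if inD31-2 σ ∧ (toℕ p ≤ᵇ toℕ (lookup σ zero)) then weight σ else 0#

      fixedPart : Perm (suc m) → Carrier
      fixedPart σ = if does (lookup σ zero ≟ᶠ zero) then contribution (insertAfterZero p σ) else 0#

    contribution-insert : (σ : Perm (suc m)) → IsPerm σ → contribution (insertAfterZero p σ) ≈ nonFixedPart σ + fixedPart σ
    contribution-insert σ inj = byCase (lookup σ zero ≟ᶠ zero)
      where
      byCase : (d : Dec (lookup σ zero ≡ zero)) →
               contribution (insertAfterZero p σ) ≈ nonFixedPart σ + (if does d then contribution (insertAfterZero p σ) else 0#)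
      byCase (yes σ0≡0) = ≈-trans (≈-sym (+-identityˡ _)) (+-congʳ (≈-sym vanishes))
        where
        vanishes : nonFixedPart σ ≈ 0#
        vanishes with inD31-2 σ in good
        ... | false = ≈-refl
        ... | true  = ⊥-elim (inD31-2-nonFixed σ good σ0≡0)
      byCase (no σ0≢0) = ≈-trans (if-cong (inD31-2-insert p σ inj σ0≢0) (reflexive (cong (pow y) (InsertedCycles.μ-insert p σ inj))))
                                 (≈-sym (+-identityʳ _))

    sum-fixedPart : sumR (map fixedPart (perms (suc m))) ≈ y * sumWhere (perms m) (λ τ → inD31-2 τ ∧ (toℕ p ≤ᵇ 1)) weight
    sum-fixedPart = begin
      sumR (map fixedPart (perms (suc m)))
        ≈⟨ sumR-filter (λ σ → lookup σ zero ≟ᶠ zero) (contribution ∘ insertAfterZero p) (perms (suc m)) ⟨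
      sumR (map (contribution ∘ insertAfterZero p) (filter (λ σ → lookup σ zero ≟ᶠ zero) (perms (suc m))))
        ≈⟨ sumR-map-↭ (contribution ∘ insertAfterZero p) perms-fixingZero ⟩
      sumR (map (contribution ∘ insertAfterZero p) (map fixZero (perms m)))
        ≡⟨ cong sumR (List.map-∘ (perms m)) ⟨
      sumR (map (contribution ∘ insertAfterZero p ∘ fixZero) (perms m))
        ≈⟨ sumR-map-cong (perms m) (λ τ τ∈ → contributionFixZero τ (∈-perms⁻ τ∈)) ⟩
      sumWhere (perms m) (λ τ → inD31-2 τ ∧ (toℕ p ≤ᵇ 1)) (λ τ → y * weight τ)
        ≈⟨ sumWhere-*ˡ y (λ τ → inD31-2 τ ∧ (toℕ p ≤ᵇ 1)) weight (perms m) ⟩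
      y * sumWhere (perms m) (λ τ → inD31-2 τ ∧ (toℕ p ≤ᵇ 1)) weight ∎
      where
      contributionFixZero : ∀ τ → IsPerm τ →
                            contribution (insertAfterZero p (fixZero τ)) ≈ (if inD31-2 τ ∧ (toℕ p ≤ᵇ 1) then y * weight τ else 0#)
      contributionFixZero τ inj = if-cong (inD31-2-insert-fixZero p τ inj)
        (reflexive (cong (pow y) (trans (InsertedCycles.μ-insert p (fixZero τ) (fixZero-isPerm inj)) (FixedCycles.μ-fixZero τ inj))))

    a2-insertAfterZero : a2 y (suc (suc m)) (label (suc p)) ≈
      sumWhere (perms (suc m)) (λ σ → inD31-2 σ ∧ (toℕ p ≤ᵇ toℕ (lookup σ zero))) weight
      + y * sumWhere (perms m) (λ τ → inD31-2 τ ∧ (toℕ p ≤ᵇ 1)) weight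
    a2-insertAfterZero = begin
      a2 y (suc (suc m)) (label (suc p))
        ≈⟨ a2-sumWhere (suc m) (label (suc p)) ⟩
      sumWhere (perms (suc (suc m))) (λ π → inD31-2 π ∧ (label (lookup π zero) ≡ᵇ label (suc p))) weight
        ≈⟨ sumR-map-cong (perms (suc (suc m))) (λ π _ → startsWith π) ⟩
      sumWhere (perms (suc (suc m))) (λ π → does (lookup π zero ≟ᶠ suc p)) contribution
        ≈⟨ sumR-filter (λ π → lookup π zero ≟ᶠ suc p) contribution (perms (suc (suc m))) ⟨
      sumR (map contribution (filter (λ π → lookup π zero ≟ᶠ suc p) (perms (suc (suc m)))))
        ≈⟨ sumR-map-↭ contribution (perms-startingWith p) ⟩
      sumR (map contribution (map (insertAfterZero p) (perms (suc m))))
        ≡⟨ cong sumR (List.map-∘ (perms (suc m))) ⟨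
      sumR (map (contribution ∘ insertAfterZero p) (perms (suc m)))
        ≈⟨ sumR-map-cong (perms (suc m)) (λ σ σ∈ → contribution-insert σ (∈-perms⁻ σ∈)) ⟩
      sumR (map (λ σ → nonFixedPart σ + fixedPart σ) (perms (suc m)))
        ≈⟨ sumR-map-+ nonFixedPart fixedPart (perms (suc m)) ⟩
      sumR (map nonFixedPart (perms (suc m))) + sumR (map fixedPart (perms (suc m)))
        ≈⟨ +-congˡ sum-fixedPart ⟩
      sumWhere (perms (suc m)) (λ σ → inD31-2 σ ∧ (toℕ p ≤ᵇ toℕ (lookup σ zero))) weight
      + y * sumWhere (perms m) (λ τ → inD31-2 τ ∧ (toℕ p ≤ᵇ 1)) weight ∎
      where
      startsWith : ∀ π → (if inD31-2 π ∧ (label (lookup π zero) ≡ᵇ label (suc p)) then weight π else 0#)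
                         ≈ (if does (lookup π zero ≟ᶠ suc p) then contribution π else 0#)
      startsWith π rewrite toℕ-≡ᵇ (lookup π zero) (suc p) with inD31-2 π | does (lookup π zero ≟ᶠ suc p)
      ... | true  | true  = ≈-refl
      ... | true  | false = ≈-refl
      ... | false | true  = ≈-refl
      ... | false | false = ≈-refl

  a2-byInsertion : ∀ m t → t < suc m → a2 y (suc (suc m)) (suc (suc t)) ≈
    sumWhere (perms (suc m)) (λ σ → inD31-2 σ ∧ (t ≤ᵇ toℕ (lookup σ zero))) weight
    + y * sumWhere (perms m) (λ τ → inD31-2 τ ∧ (t ≤ᵇ 1)) weight
  a2-byInsertion m t t< = subst
    (λ t → a2 y (suc (suc m)) (suc (suc t)) ≈
             sumWhere (perms (suc m)) (λ σ → inD31-2 σ ∧ (t ≤ᵇ toℕ (lookup σ zero))) weight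
             + y * sumWhere (perms m) (λ τ → inD31-2 τ ∧ (t ≤ᵇ 1)) weight)
    (Fin.toℕ-fromℕ< t<) (a2-insertAfterZero (fromℕ< t<))

  secondLetterAbove-rangeSum : ∀ m t → t ≤ suc m →
    sumWhere (perms (suc m)) (λ σ → inD31-2 σ ∧ (t ≤ᵇ toℕ (lookup σ zero))) weight ≈ rangeSum (a2 y (suc m)) (suc t) (suc m)
  secondLetterAbove-rangeSum m t t≤ = begin
    sumWhere (perms (suc m)) (λ σ → inD31-2 σ ∧ (t ≤ᵇ toℕ (lookup σ zero))) weight
      ≈⟨ sumWhere-cong (perms (suc m)) (λ σ _ → cong (inD31-2 σ ∧_) (sym (≤ᵇ-suc t (toℕ (lookup σ zero))))) (λ _ _ → ≈-refl) ⟩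
    sumWhere (perms (suc m)) (λ σ → inD31-2 σ ∧ (suc t ≤ᵇ label (lookup σ zero))) weight
      ≈⟨ sumWhere-≤ᵇ-rangeSum inD31-2 (λ σ → label (lookup σ zero)) weight (perms (suc m)) (suc t) (suc m) (s≤s t≤)
           (λ σ _ → Fin.toℕ<n (lookup σ zero)) ⟩
    rangeSum (λ k → sumWhere (perms (suc m)) (λ σ → inD31-2 σ ∧ (label (lookup σ zero) ≡ᵇ k)) weight) (suc t) (suc m)
      ≈⟨ rangeSum-cong (λ k → ≈-sym (a2-sumWhere m k)) (suc t) (suc m) ⟩
    rangeSum (a2 y (suc m)) (suc t) (suc m) ∎

  a2-interior : ∀ n i → 4 ≤ n → 3 ≤ i → i ≤ n ∸ 1 →
    a2 y n i ≈ δ i 3 * y * a y (n ∸ 2) + rangeSum (a2 y (n ∸ 1)) (i ∸ 1) (n ∸ 1)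
  a2-interior (suc (suc m)) (suc (suc (suc j))) _ (s≤s (s≤s (s≤s _))) (s≤s i≤m) = begin
    a2 y (suc (suc m)) (suc (suc (suc j)))
      ≈⟨ a2-byInsertion m (suc j) (ℕ.m≤n⇒m≤1+n i≤m) ⟩
    sumWhere (perms (suc m)) (λ σ → inD31-2 σ ∧ (suc j ≤ᵇ toℕ (lookup σ zero))) weight
      + y * sumWhere (perms m) (λ τ → inD31-2 τ ∧ (suc j ≤ᵇ 1)) weight
      ≈⟨ +-comm _ _ ⟩
    y * sumWhere (perms m) (λ τ → inD31-2 τ ∧ (suc j ≤ᵇ 1)) weight
      + sumWhere (perms (suc m)) (λ σ → inD31-2 σ ∧ (suc j ≤ᵇ toℕ (lookup σ zero))) weight
      ≈⟨ +-cong (fixedZeroPart j) (secondLetterAbove-rangeSum m (suc j) (ℕ.≤-trans (ℕ.n≤1+n (suc j)) (ℕ.m≤n⇒m≤1+n i≤m))) ⟩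
    δ (suc (suc (suc j))) 3 * y * a y m + rangeSum (a2 y (suc m)) (suc (suc j)) (suc m) ∎
    where
    fixedZeroPart : ∀ j → y * sumWhere (perms m) (λ τ → inD31-2 τ ∧ (suc j ≤ᵇ 1)) weight ≈ δ (suc (suc (suc j))) 3 * y * a y m
    fixedZeroPart zero = begin
      y * sumWhere (perms m) (λ τ → inD31-2 τ ∧ true) weight ≈⟨ *-congˡ (≈-trans (sumWhere-∧-true inD31-2 weight (perms m)) (≈-sym (a-sumWhere m))) ⟩
      y * a y m                                             ≈⟨ *-congʳ (*-identityˡ y) ⟨
      1# * y * a y m                                        ∎
    fixedZeroPart (suc j) = begin
      y * sumWhere (perms m) (λ τ → inD31-2 τ ∧ false) weight ≈⟨ *-congˡ (sumWhere-false weight (perms m) (λ τ _ → ∧-zeroʳ (inD31-2 τ))) ⟩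
      y * 0#                                                   ≈⟨ zeroʳ y ⟩
      0#                                                       ≈⟨ zeroˡ (a y m) ⟨
      0# * a y m                                               ≈⟨ *-congʳ (zeroˡ y) ⟨
      0# * y * a y m                                           ∎

  a2-second : ∀ n → 3 ≤ n → a2 y n 2 ≈ a y (n ∸ 1) + y * a y (n ∸ 2)
  a2-second (suc (suc m)) (s≤s (s≤s _)) = begin
    a2 y (suc (suc m)) 2
      ≈⟨ a2-byInsertion m 0 (s≤s z≤n) ⟩
    sumWhere (perms (suc m)) (λ σ → inD31-2 σ ∧ true) weight + y * sumWhere (perms m) (λ τ → inD31-2 τ ∧ true) weight
      ≈⟨ +-cong (sumWhere-∧-true inD31-2 weight (perms (suc m))) (*-congˡ (sumWhere-∧-true inD31-2 weight (perms m))) ⟩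
    sumWhere (perms (suc m)) inD31-2 weight + y * sumWhere (perms m) inD31-2 weight
      ≈⟨ +-cong (a-sumWhere (suc m)) (*-congˡ (a-sumWhere m)) ⟨
    a y (suc m) + y * a y m ∎

  a2-diagonal : ∀ m → a2 y (suc (suc m)) (suc (suc m)) ≈ y
  -- The only derangement of [2] is (1 2), and a2 y 2 2 evaluates to y * 1# + 0#.
  a2-diagonal zero    = ≈-trans (+-identityʳ (y * 1#)) (*-identityʳ y)
  a2-diagonal (suc m) = begin
    a2 y (3 ℕ.+ m) (3 ℕ.+ m)
      ≈⟨ a2-byInsertion (suc m) (suc m) ℕ.≤-refl ⟩
    sumWhere (perms (2 ℕ.+ m)) (λ σ → inD31-2 σ ∧ (suc m ≤ᵇ toℕ (lookup σ zero))) weight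
      + y * sumWhere (perms (suc m)) (λ τ → inD31-2 τ ∧ (suc m ≤ᵇ 1)) weight
      ≈⟨ +-cong lastSecondLetter (≈-trans (*-congˡ (noFixedZero m)) (zeroʳ y)) ⟩
    a2 y (2 ℕ.+ m) (2 ℕ.+ m) + 0#
      ≈⟨ +-identityʳ _ ⟩
    a2 y (2 ℕ.+ m) (2 ℕ.+ m)
      ≈⟨ a2-diagonal m ⟩
    y ∎
    where
    lastSecondLetter : sumWhere (perms (2 ℕ.+ m)) (λ σ → inD31-2 σ ∧ (suc m ≤ᵇ toℕ (lookup σ zero))) weight ≈ a2 y (2 ℕ.+ m) (2 ℕ.+ m)
    lastSecondLetter = ≈-trans
      (sumWhere-cong (perms (2 ℕ.+ m)) (λ σ _ → cong (inD31-2 σ ∧_) (≤ᵇ-≡ᵇ (ℕ.≤-pred (Fin.toℕ<n (lookup σ zero))))) (λ _ _ → ≈-refl))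
      (≈-sym (a2-sumWhere (suc m) (2 ℕ.+ m)))
    noFixedZero : ∀ m → sumWhere (perms (suc m)) (λ τ → inD31-2 τ ∧ (suc m ≤ᵇ 1)) weight ≈ 0#
    -- [1] has no derangement: a y 1 evaluates to 0#.
    noFixedZero zero    = ≈-trans (sumWhere-∧-true inD31-2 weight (perms 1)) (≈-sym (a-sumWhere 1))
    noFixedZero (suc m) = sumWhere-false weight (perms (2 ℕ.+ m)) (λ τ _ → ∧-zeroʳ (inD31-2 τ))

lemma2p2 : {c ℓ : Level} (R : CommutativeSemiring c ℓ) (y : CommutativeSemiring.Carrier R) →
    let open CommutativeSemiring R
        open Poly R
    in ((n i : ℕ) → 4 ≤ n → 3 ≤ i → i ≤ n ∸ 1 →
          a2 y n i ≈ δ i 3 * y * a y (n ∸ 2) + rangeSum (a2 y (n ∸ 1)) (i ∸ 1) (n ∸ 1))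
     × ((n : ℕ) → 3 ≤ n → a2 y n 2 ≈ a y (n ∸ 1) + y * a y (n ∸ 2))
     × ((n : ℕ) → 2 ≤ n → a2 y n n ≈ y)
lemma2p2 R y = a2-interior , a2-second , λ { (suc (suc m)) (s≤s (s≤s _)) → a2-diagonal m }
  where open Counting R y
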